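{- Let $\alpha,\beta,y,q$ be indeterminates, let $\tilde\alpha=(1-q)\frac1\alpha-1$ and $\tilde\beta=(1-q)\frac1\beta-1$, and let $Z_N=Z_N(\alpha,\beta,y,q)$ be the PASEP partition function defined in the context. Then for every $N\ge 0$, \[ Z_N=\frac{1}{(1-q)^N}\sum_{n=0}^{N}R_{N,n}(y,q)\,B_n(\tilde\alpha,\tilde\beta,y,q), \] where \[ R_{N,n}(y,q)=\sum_{i=0}^{\lfloor (N-n)/2\rfloor}(-y)^i q^{\binom{i+1}{2}}\begin{bmatrix} n+i\\ i\end{bmatrix}_q\sum_{j=0}^{N-n-2i}y^j\left(\binom{N}{j}\binom{N}{n+2i+j}-\binom{N}{j-1}\binom{N}{n+2i+j+1}\right) \] and \[ B_n(\tilde\alpha,\tilde\beta,y,q)=\sum_{k=0}^{n}\begin{bmatrix} n\\ k\end{bmatrix}_q\tilde\alpha^k(y\tilde\beta)^{n-k}. \]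
   Context: Let $\mathcal A$ be the associative algebra over $\mathbb Z[y,q]$ generated by two elements $D,E$ subject to the relation $DE-qED=D+E$. Every element of $\mathcal A$ is uniquely a finite $\mathbb Z[y,q]$-linear combination of the words $E^iD^j$ ($i,j\ge0$); write $(yD+E)^N=\sum_{i,j\ge0}c^{(N)}_{i,j}E^iD^j$ with $c^{(N)}_{i,j}\in\mathbb Z[y,q]$. The PASEP partition function is $Z_N(\alpha,\beta,y,q)=\sum_{i,j}c^{(N)}_{i,j}\alpha^{ -i}\beta^{ -j}$ (equivalently $Z_N=\langle W|(yD+E)^N|V\rangle$ for any operators $D,E$, vector $\langle W|$ and form $|V\rangle$ with $DE-qED=D+E$, $\langle W|\alpha E=\langle W|$, $\beta D|V\rangle=|V\rangle$, $\langle W|V\rangle=1$). $\begin{bmatrix} n\\ k\end{bmatrix}_q$ denotes the Gaussian $q$-binomial coefficient; ordinary binomial coefficients with negative lower index or lower index exceeding the upper one are $0$. -}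

module Defs where

open import Level using (Level)
open import Algebra.Bundles using (CommutativeRing)
open import Data.Nat as ℕ using (ℕ; zero; suc; _∸_; ⌊_/2⌋)
open import Data.Nat.Combinatorics using (_C_)
open import Data.Product using (_×_; _,_)
open import Data.List using (List; []; _∷_; _++_; map; concatMap; foldr)

-- Everything is stated over an arbitrary commutative ring R; the elements
-- y, q, a, b of R play the role of the indeterminates y, q, 1/α, 1/β.
module Ops {c ℓ : Level} (R : CommutativeRing c ℓ) where
  open CommutativeRing R using (Carrier; _+_; _*_; -_; _-_; 0#; 1#)

  pow : Carrier → ℕ → Carrier
  pow x zero    = 1#
  pow x (suc n) = x * pow x n

  fromℕ : ℕ → Carrier
  fromℕ zero    = 0#
  fromℕ (suc n) = 1# + fromℕ n

  sumTo : ℕ → (ℕ → Carrier) → Carrier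
  sumTo zero    f = f zero
  sumTo (suc m) f = sumTo m f + f (suc m)

  qbinom : Carrier → ℕ → ℕ → Carrier
  qbinom q n       zero    = 1#
  qbinom q zero    (suc k) = 0#
  qbinom q (suc n) (suc k) = qbinom q n k + pow q (suc k) * qbinom q n (suc k)

  -- The algebra A: D E - q E D = D + E.  An element is represented by a list
  -- of terms (coefficient , i , j) standing for  Σ coefficient · E^i D^j.

  Term : Set c
  Term = Carrier × ℕ × ℕ

  -- normal ordered form of D^j E, computed by  D^(j+1) E = D (D^j E)  and
  --   D · E D^k = (qED + D + E) D^k = q E D^(k+1) + D^(k+1) + E D^k,
  --   D · D^k   = D^(k+1).
  -- (terms here have E-exponent 0 or 1)
  DpowE : Carrier → ℕ → List Term
  DpowE q zero    = (1# , 1 , 0) ∷ []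
  DpowE q (suc j) = concatMap stepD (DpowE q j)
    where
    stepD : Term → List Term
    stepD (x , zero  , k) = (x , 0 , suc k) ∷ []
    stepD (x , suc _ , k) = (q * x , 1 , suc k) ∷ (x , 0 , suc k) ∷ (x , 1 , k) ∷ []

  mulE : Carrier → Term → List Term
  mulE q (x , i , j) = map (λ { (x′ , e , k) → (x * x′ , i ℕ.+ e , k) }) (DpowE q j)

  mulD : Term → Term
  mulD (x , i , j) = (x , i , suc j)

  mulYDE : Carrier → Carrier → List Term → List Term
  mulYDE y q = concatMap (λ t → scale y (mulD t) ∷ mulE q t)
    where
    scale : Carrier → Term → Term
    scale y (x , i , j) = (y * x , i , j)

  powYDE : Carrier → Carrier → ℕ → List Term
  powYDE y q zero    = (1# , 0 , 0) ∷ []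
  powYDE y q (suc N) = mulYDE y q (powYDE y q N)

  -- PASEP partition function Z_N = Σ c_{ij} α^{-i} β^{-j}, with a = 1/α, b = 1/β
  Z : ℕ → (a b y q : Carrier) → Carrier
  Z N a b y q = foldr (λ { (x , i , j) acc → x * pow a i * pow b j + acc }) 0# (powYDE y q N)

  binomPred : ℕ → ℕ → ℕ
  binomPred N zero    = 0
  binomPred N (suc j) = N C j

  Rcoef : Carrier → Carrier → ℕ → ℕ → Carrier
  Rcoef y q N n =
    sumTo ⌊ (N ∸ n) /2⌋ λ i →
      pow (- y) i * pow q (suc i C 2) * qbinom q (n ℕ.+ i) i *
      sumTo (N ∸ n ∸ 2 ℕ.* i) λ j →
        pow y j * (fromℕ ((N C j) ℕ.* (N C (n ℕ.+ 2 ℕ.* i ℕ.+ j)))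
                   - fromℕ ((binomPred N j) ℕ.* (N C (n ℕ.+ 2 ℕ.* i ℕ.+ j ℕ.+ 1))))

  Bpoly : ℕ → (αt βt y q : Carrier) → Carrier
  Bpoly n αt βt y q = sumTo n λ k → qbinom q n k * pow αt k * pow (y * βt) (n ∸ k)

  tilde : Carrier → Carrier → Carrier
  tilde q a = (1# - q) * a - 1#

-- Put d = (1-q)D - 1 and e = (1-q)E - 1. The relation becomes de - q ed = 1 - q, and
-- (1-q)(yD + E) = (1+y) + y d + e. Since d|V⟩ = β̃|V⟩ and ⟨W|e = α̃⟨W|, the vectors
-- hₙ = Σₖ [n k]_q (yβ̃)ⁿ⁻ᵏ eᵏ|V⟩ satisfy ((1+y) + y d + e) hₙ = (1+y) hₙ + hₙ₊₁ + y(1-qⁿ) hₙ₋₁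
-- and ⟨W|hₙ⟩ = Bₙ(α̃, β̃, y, q). Hence (1-q)ᴺ Z_N = Σₙ R_{N,n} Bₙ for every family with R_{0,0} = 1,
-- R_{N,n} = 0 for n > N and R_{N+1,n} = (1+y) R_{N,n} + R_{N,n-1} + y(1-qⁿ⁺¹) R_{N,n+1}.
-- The explicit R_{N,n} is Σᵢ ωᵢ(n) T_N(n+2i) with ωᵢ(n) = (-y)ⁱ q^(i+1 choose 2) [n+i i]_q,
-- T_N(m) = A_N(m) - y A_N(m+2) and A_N(m) = Σⱼ yʲ (N choose j)(N choose m+j). Pascal's rule gives
-- A, hence T, a three-term recursion in N, and the q-Pascal rule turns it into the one for R.

module Submission where

open import Defs
open import Level using (Level)
open import Algebra.Bundles using (CommutativeRing; RawRing)
open import Data.Nat using (ℕ)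
open import Data.Nat as ℕ using (zero; suc; _∸_; _≤_; _<_; z≤n; s≤s; ⌊_/2⌋)
import Data.Nat.Properties as ℕₚ
open import Data.Nat.GeneralisedArithmetic using (fold)
open import Data.Nat.Combinatorics using (_C_; nCk+nC[k+1]≡[n+1]C[k+1]; nC1≡n)
open import Data.Nat.Combinatorics.Specification using (k>n⇒nCk≡0)
open import Data.Maybe using (Maybe; just; nothing)
open import Data.Product using (_,_)
open import Data.Sum using (inj₁; inj₂)
open import Data.List using (List; []; _∷_; _++_; map; concatMap; foldr; concat)
open import Function using (_∘_)
open import Relation.Binary.PropositionalEquality as ≡ using (_≡_)
open import Relation.Nullary using (yes; no)

-- The library ring solver needs a coefficient ring with decidable equality mapped into R.
-- We use integers written as differences m ⊖ n of naturals, in the normal form where one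
-- side is 0. The embedding avoids the trailing + 0# of fromℕ, so that 0 ⊖ 0 and 1 ⊖ 0 denote
-- 0# and 1# on the nose and solver equations match goals definitionally.
module IntegerCoefficientSolver {c ℓ : Level} (R : CommutativeRing c ℓ) where
  open CommutativeRing R hiding (zero)
  open Ops R using (fromℕ)
  open import Relation.Binary.Reasoning.Setoid setoid
  open import Algebra.Properties.Ring ring using (x[y-z]≈xy-xz; [y-z]x≈yx-zx)
  open import Algebra.Properties.AbelianGroup +-abelianGroup using (⁻¹-∙-comm; ⁻¹-anti-homo‿-; ε⁻¹≈ε)
  open import Algebra.Properties.CommutativeSemigroup +-commutativeSemigroup using (interchange)
  import Algebra.Solver.Ring.AlmostCommutativeRing as ACR
  import Algebra.Solver.Ring as RingSolver

  -‿+-interchange : ∀ a b c d → (a - b) + (c - d) ≈ (a + c) - (b + d)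
  -‿+-interchange a b c d = trans (interchange a (- b) c (- d)) (+-congˡ (⁻¹-∙-comm b d))

  [a-b][c-d] : ∀ a b c d → (a - b) * (c - d) ≈ (a * c + b * d) - (a * d + b * c)
  [a-b][c-d] a b c d = begin
    (a - b) * (c - d)                 ≈⟨ [y-z]x≈yx-zx (c - d) a b ⟩
    a * (c - d) - b * (c - d)         ≈⟨ +-cong (x[y-z]≈xy-xz a c d) (-‿cong (x[y-z]≈xy-xz b c d)) ⟩
    (a * c - a * d) - (b * c - b * d) ≈⟨ +-congˡ (⁻¹-anti-homo‿- (b * c) (b * d)) ⟩
    (a * c - a * d) + (b * d - b * c) ≈⟨ -‿+-interchange (a * c) (a * d) (b * d) (b * c) ⟩
    (a * c + b * d) - (a * d + b * c) ∎

  [1+a]-[1+b] : ∀ a b → (1# + a) - (1# + b) ≈ a - b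
  [1+a]-[1+b] a b = begin
    (1# + a) - (1# + b) ≈⟨ -‿+-interchange 1# 1# a b ⟨
    (1# - 1#) + (a - b) ≈⟨ +-congʳ (-‿inverseʳ 1#) ⟩
    0# + (a - b)        ≈⟨ +-identityˡ _ ⟩
    a - b               ∎

  fromℕ-+ : ∀ m n → fromℕ (m ℕ.+ n) ≈ fromℕ m + fromℕ n
  fromℕ-+ zero    n = sym (+-identityˡ _)
  fromℕ-+ (suc m) n = trans (+-congˡ (fromℕ-+ m n)) (sym (+-assoc _ _ _))

  fromℕ-* : ∀ m n → fromℕ (m ℕ.* n) ≈ fromℕ m * fromℕ n
  fromℕ-* zero    n = sym (zeroˡ _)
  fromℕ-* (suc m) n = begin
    fromℕ (n ℕ.+ m ℕ.* n)             ≈⟨ fromℕ-+ n (m ℕ.* n) ⟩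
    fromℕ n + fromℕ (m ℕ.* n)         ≈⟨ +-cong (sym (*-identityˡ _)) (fromℕ-* m n) ⟩
    1# * fromℕ n + fromℕ m * fromℕ n  ≈⟨ distribʳ _ _ _ ⟨
    (1# + fromℕ m) * fromℕ n          ∎

  fromℕ[m∸n]-fromℕ[n∸m] : ∀ m n → fromℕ (m ∸ n) - fromℕ (n ∸ m) ≈ fromℕ m - fromℕ n
  fromℕ[m∸n]-fromℕ[n∸m] zero    zero    = refl
  fromℕ[m∸n]-fromℕ[n∸m] zero    (suc n) = refl
  fromℕ[m∸n]-fromℕ[n∸m] (suc m) zero    = refl
  fromℕ[m∸n]-fromℕ[n∸m] (suc m) (suc n) = trans (fromℕ[m∸n]-fromℕ[n∸m] m n) (sym ([1+a]-[1+b] _ _))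

  record Diff : Set where
    constructor _⊖_
    field pos neg : ℕ

  normalise : ℕ → ℕ → Diff
  normalise m n = (m ∸ n) ⊖ (n ∸ m)

  Diff-rawRing : RawRing _ _
  Diff-rawRing = record
    { Carrier = Diff
    ; _≈_     = _≡_
    ; _+_     = λ { (a ⊖ b) (c ⊖ d) → normalise (a ℕ.+ c) (b ℕ.+ d) }
    ; _*_     = λ { (a ⊖ b) (c ⊖ d) → normalise (a ℕ.* c ℕ.+ b ℕ.* d) (a ℕ.* d ℕ.+ b ℕ.* c) }
    ; -_      = λ { (a ⊖ b) → b ⊖ a }
    ; 0#      = 0 ⊖ 0
    ; 1#      = 1 ⊖ 0
    }

  fromℕ⁺ : ℕ → Carrier
  fromℕ⁺ zero    = 1#
  fromℕ⁺ (suc n) = 1# + fromℕ⁺ n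

  fromℕ⁺≈fromℕ[1+n] : ∀ n → fromℕ⁺ n ≈ fromℕ (suc n)
  fromℕ⁺≈fromℕ[1+n] zero    = sym (+-identityʳ 1#)
  fromℕ⁺≈fromℕ[1+n] (suc n) = +-congˡ (fromℕ⁺≈fromℕ[1+n] n)

  ⟦_⟧ : Diff → Carrier
  ⟦ zero  ⊖ zero  ⟧ = 0#
  ⟦ suc a ⊖ zero  ⟧ = fromℕ⁺ a
  ⟦ zero  ⊖ suc b ⟧ = - fromℕ⁺ b
  ⟦ suc a ⊖ suc b ⟧ = ⟦ a ⊖ b ⟧

  ⟦⊖⟧ : ∀ a b → ⟦ a ⊖ b ⟧ ≈ fromℕ a - fromℕ b
  ⟦⊖⟧ zero    zero    = sym (-‿inverseʳ 0#)
  ⟦⊖⟧ (suc a) zero    = trans (fromℕ⁺≈fromℕ[1+n] a) (sym (trans (+-congˡ ε⁻¹≈ε) (+-identityʳ _)))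
  ⟦⊖⟧ zero    (suc b) = trans (-‿cong (fromℕ⁺≈fromℕ[1+n] b)) (sym (+-identityˡ _))
  ⟦⊖⟧ (suc a) (suc b) = trans (⟦⊖⟧ a b) (sym ([1+a]-[1+b] _ _))

  ⟦normalise⟧ : ∀ m n → ⟦ normalise m n ⟧ ≈ fromℕ m - fromℕ n
  ⟦normalise⟧ m n = trans (⟦⊖⟧ (m ∸ n) (n ∸ m)) (fromℕ[m∸n]-fromℕ[n∸m] m n)

  almostCommutativeRing : ACR.AlmostCommutativeRing c ℓ
  almostCommutativeRing = ACR.fromCommutativeRing R

  ⟦⟧-homomorphism : Diff-rawRing ACR.-Raw-AlmostCommutative⟶ almostCommutativeRing
  ⟦⟧-homomorphism = record
    { ⟦_⟧    = ⟦_⟧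
    ; +-homo = λ { (a ⊖ b) (c ⊖ d) → begin
        ⟦ normalise (a ℕ.+ c) (b ℕ.+ d) ⟧           ≈⟨ ⟦normalise⟧ (a ℕ.+ c) (b ℕ.+ d) ⟩
        fromℕ (a ℕ.+ c) - fromℕ (b ℕ.+ d)           ≈⟨ +-cong (fromℕ-+ a c) (-‿cong (fromℕ-+ b d)) ⟩
        (fromℕ a + fromℕ c) - (fromℕ b + fromℕ d)   ≈⟨ -‿+-interchange _ _ _ _ ⟨
        (fromℕ a - fromℕ b) + (fromℕ c - fromℕ d)   ≈⟨ +-cong (⟦⊖⟧ a b) (⟦⊖⟧ c d) ⟨
        ⟦ a ⊖ b ⟧ + ⟦ c ⊖ d ⟧                       ∎ }
    ; *-homo = λ { (a ⊖ b) (c ⊖ d) → begin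
        ⟦ normalise (a ℕ.* c ℕ.+ b ℕ.* d) (a ℕ.* d ℕ.+ b ℕ.* c) ⟧
          ≈⟨ ⟦normalise⟧ (a ℕ.* c ℕ.+ b ℕ.* d) (a ℕ.* d ℕ.+ b ℕ.* c) ⟩
        fromℕ (a ℕ.* c ℕ.+ b ℕ.* d) - fromℕ (a ℕ.* d ℕ.+ b ℕ.* c)
          ≈⟨ +-cong (fromℕ-+·* a c b d) (-‿cong (fromℕ-+·* a d b c)) ⟩
        (fromℕ a * fromℕ c + fromℕ b * fromℕ d) - (fromℕ a * fromℕ d + fromℕ b * fromℕ c)
          ≈⟨ [a-b][c-d] _ _ _ _ ⟨
        (fromℕ a - fromℕ b) * (fromℕ c - fromℕ d)
          ≈⟨ *-cong (⟦⊖⟧ a b) (⟦⊖⟧ c d) ⟨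
        ⟦ a ⊖ b ⟧ * ⟦ c ⊖ d ⟧ ∎ }
    ; -‿homo = λ { (a ⊖ b) → begin
        ⟦ b ⊖ a ⟧               ≈⟨ ⟦⊖⟧ b a ⟩
        fromℕ b - fromℕ a       ≈⟨ ⁻¹-anti-homo‿- (fromℕ a) (fromℕ b) ⟨
        - (fromℕ a - fromℕ b)   ≈⟨ -‿cong (⟦⊖⟧ a b) ⟨
        - ⟦ a ⊖ b ⟧             ∎ }
    ; 0-homo = refl
    ; 1-homo = refl
    }
    where
    fromℕ-+·* : ∀ a c b d → fromℕ (a ℕ.* c ℕ.+ b ℕ.* d) ≈ fromℕ a * fromℕ c + fromℕ b * fromℕ d
    fromℕ-+·* a c b d = trans (fromℕ-+ (a ℕ.* c) (b ℕ.* d)) (+-cong (fromℕ-* a c) (fromℕ-* b d))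

  _≟⟦⟧_ : ∀ x y → Maybe (⟦ x ⟧ ≈ ⟦ y ⟧)
  (a ⊖ b) ≟⟦⟧ (c ⊖ d) with a ℕ.≟ c | b ℕ.≟ d
  ... | yes ≡.refl | yes ≡.refl = just refl
  ... | _          | _          = nothing

  open RingSolver Diff-rawRing almostCommutativeRing ⟦⟧-homomorphism _≟⟦⟧_ public
    using (solve; _:=_; _:+_; _:*_; _:-_; :-_; con; Polynomial)

  :0 :1 : ∀ {n} → Polynomial n
  :0 = con (0 ⊖ 0)
  :1 = con (1 ⊖ 0)

module Sums {c ℓ : Level} (R : CommutativeRing c ℓ) where
  open CommutativeRing R hiding (zero)
  open Ops R
  open import Algebra.Properties.AbelianGroup +-abelianGroup using (⁻¹-∙-comm)
  open import Algebra.Properties.CommutativeSemigroup +-commutativeSemigroup using (interchange)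

  sumTo-cong-≤ : ∀ m {f g : ℕ → Carrier} → (∀ k → k ≤ m → f k ≈ g k) → sumTo m f ≈ sumTo m g
  sumTo-cong-≤ zero    f≈g = f≈g 0 z≤n
  sumTo-cong-≤ (suc m) f≈g = +-cong (sumTo-cong-≤ m (λ k k≤m → f≈g k (ℕₚ.m≤n⇒m≤1+n k≤m))) (f≈g (suc m) ℕₚ.≤-refl)

  sumTo-cong : ∀ m {f g : ℕ → Carrier} → (∀ k → f k ≈ g k) → sumTo m f ≈ sumTo m g
  sumTo-cong m f≈g = sumTo-cong-≤ m (λ k _ → f≈g k)

  sumTo-zero : ∀ m {f : ℕ → Carrier} → (∀ k → k ≤ m → f k ≈ 0#) → sumTo m f ≈ 0#
  sumTo-zero zero    f≈0 = f≈0 0 z≤n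
  sumTo-zero (suc m) f≈0 = trans (+-cong (sumTo-zero m (λ k k≤m → f≈0 k (ℕₚ.m≤n⇒m≤1+n k≤m))) (f≈0 (suc m) ℕₚ.≤-refl)) (+-identityʳ _)

  sumTo-distrib-+ : ∀ m (f g : ℕ → Carrier) → sumTo m (λ k → f k + g k) ≈ sumTo m f + sumTo m g
  sumTo-distrib-+ zero    f g = refl
  sumTo-distrib-+ (suc m) f g = trans (+-congʳ (sumTo-distrib-+ m f g)) (interchange _ _ _ _)

  *-distribˡ-sumTo : ∀ m x (f : ℕ → Carrier) → x * sumTo m f ≈ sumTo m (λ k → x * f k)
  *-distribˡ-sumTo zero    x f = refl
  *-distribˡ-sumTo (suc m) x f = trans (distribˡ _ _ _) (+-congʳ (*-distribˡ-sumTo m x f))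

  -‿distrib-sumTo : ∀ m (f : ℕ → Carrier) → - sumTo m f ≈ sumTo m (λ k → - f k)
  -‿distrib-sumTo zero    f = refl
  -‿distrib-sumTo (suc m) f = trans (sym (⁻¹-∙-comm _ _)) (+-congʳ (-‿distrib-sumTo m f))

  sumTo-sucˡ : ∀ m (f : ℕ → Carrier) → sumTo (suc m) f ≈ f 0 + sumTo m (f ∘ suc)
  sumTo-sucˡ zero    f = refl
  sumTo-sucˡ (suc m) f = trans (+-congʳ (sumTo-sucˡ m f)) (+-assoc _ _ _)

  sumTo-extend : ∀ {m} M {f : ℕ → Carrier} → m ≤ M → (∀ k → m < k → f k ≈ 0#) → sumTo M f ≈ sumTo m f
  sumTo-extend zero    z≤n _ = refl
  sumTo-extend (suc M) m≤1+M f≈0 with ℕₚ.m≤n⇒m<n∨m≡n m≤1+M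
  ... | inj₂ ≡.refl       = refl
  ... | inj₁ (s≤s m≤M)   = trans (+-cong (sumTo-extend M m≤M f≈0) (f≈0 (suc M) (s≤s m≤M))) (+-identityʳ _)

  sumList : (Term → Carrier) → List Term → Carrier
  sumList φ = foldr (λ t acc → φ t + acc) 0#

  sumList-++ : ∀ φ xs ys → sumList φ (xs ++ ys) ≈ sumList φ xs + sumList φ ys
  sumList-++ φ []       ys = sym (+-identityˡ _)
  sumList-++ φ (x ∷ xs) ys = trans (+-congˡ (sumList-++ φ xs ys)) (sym (+-assoc _ _ _))

  sumList-concatMap : ∀ φ (f : Term → List Term) ts → sumList φ (concatMap f ts) ≈ sumList (sumList φ ∘ f) ts
  sumList-concatMap φ f []       = refl
  sumList-concatMap φ f (t ∷ ts) = trans (sumList-++ φ (f t) (concat (map f ts))) (+-congˡ (sumList-concatMap φ f ts))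

  sumList-map : ∀ φ (f : Term → Term) ts → sumList φ (map f ts) ≈ sumList (φ ∘ f) ts
  sumList-map φ f []       = refl
  sumList-map φ f (t ∷ ts) = +-congˡ (sumList-map φ f ts)

  sumList-cong : ∀ {φ ψ} ts → (∀ t → φ t ≈ ψ t) → sumList φ ts ≈ sumList ψ ts
  sumList-cong []       φ≈ψ = refl
  sumList-cong (t ∷ ts) φ≈ψ = +-cong (φ≈ψ t) (sumList-cong ts φ≈ψ)

  sumList-concatMap-cong : ∀ φ {ψ} (f : Term → List Term) ts →
                           (∀ t → sumList φ (f t) ≈ ψ t) → sumList φ (concatMap f ts) ≈ sumList ψ ts
  sumList-concatMap-cong φ f ts φf≈ψ = trans (sumList-concatMap φ f ts) (sumList-cong ts φf≈ψ)

  sumList-distrib-+ : ∀ φ ψ ts → sumList (λ t → φ t + ψ t) ts ≈ sumList φ ts + sumList ψ ts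
  sumList-distrib-+ φ ψ []       = sym (+-identityˡ _)
  sumList-distrib-+ φ ψ (t ∷ ts) = trans (+-congˡ (sumList-distrib-+ φ ψ ts)) (interchange _ _ _ _)

  *-distribˡ-sumList : ∀ x φ ts → x * sumList φ ts ≈ sumList (λ t → x * φ t) ts
  *-distribˡ-sumList x φ []       = zeroʳ _
  *-distribˡ-sumList x φ (t ∷ ts) = trans (distribˡ _ _ _) (+-congˡ (*-distribˡ-sumList x φ ts))

  pow-+ : ∀ x m n → pow x (m ℕ.+ n) ≈ pow x m * pow x n
  pow-+ x zero    n = sym (*-identityˡ _)
  pow-+ x (suc m) n = trans (*-congˡ (pow-+ x m n)) (sym (*-assoc _ _ _))

module QBinomial {c ℓ : Level} (R : CommutativeRing c ℓ) (q : CommutativeRing.Carrier R) where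
  open CommutativeRing R hiding (zero)
  open Ops R
  open IntegerCoefficientSolver R
  open Sums R
  open import Relation.Binary.Reasoning.Setoid setoid

  qb : ℕ → ℕ → Carrier
  qb = qbinom q

  k>n⇒qbinom≈0 : ∀ n k → n < k → qb n k ≈ 0#
  k>n⇒qbinom≈0 zero    (suc k) _         = refl
  k>n⇒qbinom≈0 (suc n) (suc k) (s≤s n<k) = begin
    qb n k + pow q (suc k) * qb n (suc k) ≈⟨ +-cong (k>n⇒qbinom≈0 n k n<k) (*-congˡ (k>n⇒qbinom≈0 n (suc k) (ℕₚ.m<n⇒m<1+n n<k))) ⟩
    0# + pow q (suc k) * 0#               ≈⟨ solve 1 (λ x → :0 :+ x :* :0 := :0) refl _ ⟩
    0#                                    ∎

  qbinom-diag : ∀ n → qb n n ≈ 1#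
  qbinom-diag zero    = refl
  qbinom-diag (suc n) = begin
    qb n n + pow q (suc n) * qb n (suc n) ≈⟨ +-cong (qbinom-diag n) (*-congˡ (k>n⇒qbinom≈0 n (suc n) ℕₚ.≤-refl)) ⟩
    1# + pow q (suc n) * 0#               ≈⟨ solve 1 (λ x → :1 :+ x :* :0 := :1) refl _ ⟩
    1#                                    ∎

  qbinom-suc-lower : ∀ k r → (1# - pow q (suc k)) * qb (k ℕ.+ r) (suc k) ≈ (1# - pow q r) * qb (k ℕ.+ r) k
  qbinom-suc-lower zero zero = solve 1 (λ q → (:1 :- q :* :1) :* :0 := (:1 :- :1) :* :1) refl q
  qbinom-suc-lower zero (suc r) = begin
    (1# - q * 1#) * (1# + (q * 1#) * qb r 1)
      ≈⟨ solve 2 (λ q F → (:1 :- q :* :1) :* (:1 :+ (q :* :1) :* F) := (:1 :- q :* :1) :+ q :* ((:1 :- q :* :1) :* F)) refl q (qb r 1) ⟩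
    (1# - q * 1#) + q * ((1# - q * 1#) * qb r 1)
      ≈⟨ +-congˡ (*-congˡ (qbinom-suc-lower zero r)) ⟩
    (1# - q * 1#) + q * ((1# - pow q r) * 1#)
      ≈⟨ solve 2 (λ q P → (:1 :- q :* :1) :+ q :* ((:1 :- P) :* :1) := (:1 :- q :* P) :* :1) refl q (pow q r) ⟩
    (1# - q * pow q r) * 1# ∎
  qbinom-suc-lower (suc k) zero = begin
    (1# - pow q (suc (suc k))) * qb (suc (k ℕ.+ 0)) (suc (suc k)) ≈⟨ *-congˡ (k>n⇒qbinom≈0 _ _ (s≤s (s≤s (ℕₚ.≤-reflexive (ℕₚ.+-identityʳ k))))) ⟩
    (1# - pow q (suc (suc k))) * 0#                              ≈⟨ solve 2 (λ A F → A :* :0 := (:1 :- :1) :* F) refl _ _ ⟩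
    (1# - 1#) * qb (suc (k ℕ.+ 0)) (suc k)                       ∎
  qbinom-suc-lower (suc k) (suc r) = begin
    (1# - q * A) * (F₁ + (q * A) * F₂)
      ≈⟨ solve 4 (λ q A F₁ F₂ → (:1 :- q :* A) :* (F₁ :+ (q :* A) :* F₂) := (:1 :- q :* A) :* F₁ :+ (q :* A) :* ((:1 :- q :* A) :* F₂)) refl q A F₁ F₂ ⟩
    (1# - q * A) * F₁ + (q * A) * ((1# - q * A) * F₂)
      ≈⟨ +-congˡ (*-congˡ IH₂) ⟩
    (1# - q * A) * F₁ + (q * A) * ((1# - Qr) * F₁)
      ≈⟨ solve 4 (λ q A Qr F₁ → (:1 :- q :* A) :* F₁ :+ (q :* A) :* ((:1 :- Qr) :* F₁) := (:1 :- A) :* F₁ :+ (:1 :- q :* Qr) :* A :* F₁) refl q A Qr F₁ ⟩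
    (1# - A) * F₁ + (1# - q * Qr) * A * F₁
      ≈⟨ +-congʳ (qbinom-suc-lower k (suc r)) ⟩
    (1# - q * Qr) * F₀ + (1# - q * Qr) * A * F₁
      ≈⟨ solve 5 (λ q A Qr F₁ F₀ → (:1 :- q :* Qr) :* F₀ :+ (:1 :- q :* Qr) :* A :* F₁ := (:1 :- q :* Qr) :* (F₀ :+ A :* F₁)) refl q A Qr F₁ F₀ ⟩
    (1# - q * Qr) * (F₀ + A * F₁) ∎
    where
    A  = pow q (suc k)
    Qr = pow q r
    F₀ = qb (k ℕ.+ suc r) k
    F₁ = qb (k ℕ.+ suc r) (suc k)
    F₂ = qb (k ℕ.+ suc r) (suc (suc k))
    IH₂ : (1# - q * A) * F₂ ≈ (1# - Qr) * F₁
    IH₂ = ≡.subst (λ n → (1# - q * A) * qb n (suc (suc k)) ≈ (1# - Qr) * qb n (suc k)) (≡.sym (ℕₚ.+-suc k r)) (qbinom-suc-lower (suc k) r)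

  qbinom-suc-lower′ : ∀ n k → (pow q k - pow q n) * qb n k ≈ pow q k * (1# - pow q (suc k)) * qb n (suc k)
  qbinom-suc-lower′ n k with k ℕ.≤? n
  ... | no  k≰n = begin
    (pow q k - pow q n) * qb n k                  ≈⟨ *-congˡ (k>n⇒qbinom≈0 n k n<k) ⟩
    (pow q k - pow q n) * 0#                      ≈⟨ solve 2 (λ A B → A :* :0 := B :* :0) refl _ _ ⟩
    pow q k * (1# - pow q (suc k)) * 0#           ≈⟨ *-congˡ (k>n⇒qbinom≈0 n (suc k) (ℕₚ.m<n⇒m<1+n n<k)) ⟨
    pow q k * (1# - pow q (suc k)) * qb n (suc k) ∎
    where n<k = ℕₚ.≰⇒> k≰n
  ... | yes k≤n = ≡.subst (λ n → (pow q k - pow q n) * qb n k ≈ pow q k * (1# - pow q (suc k)) * qb n (suc k))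
                          (ℕₚ.m+[n∸m]≡n k≤n) (shifted (n ∸ k))
    where
    shifted : ∀ r → (pow q k - pow q (k ℕ.+ r)) * qb (k ℕ.+ r) k ≈ pow q k * (1# - pow q (suc k)) * qb (k ℕ.+ r) (suc k)
    shifted r = begin
      (pow q k - pow q (k ℕ.+ r)) * qb (k ℕ.+ r) k          ≈⟨ *-congʳ (+-congˡ (-‿cong (pow-+ q k r))) ⟩
      (pow q k - pow q k * pow q r) * qb (k ℕ.+ r) k        ≈⟨ solve 3 (λ P Q F → (P :- P :* Q) :* F := P :* ((:1 :- Q) :* F)) refl _ _ _ ⟩
      pow q k * ((1# - pow q r) * qb (k ℕ.+ r) k)           ≈⟨ *-congˡ (qbinom-suc-lower k r) ⟨
      pow q k * ((1# - pow q (suc k)) * qb (k ℕ.+ r) (suc k)) ≈⟨ *-assoc _ _ _ ⟨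
      pow q k * (1# - pow q (suc k)) * qb (k ℕ.+ r) (suc k) ∎

  qbinom-suc-both : ∀ n k → (1# - pow q (suc k)) * qb (suc n) (suc k) ≈ (1# - pow q (suc n)) * qb n k
  qbinom-suc-both zero zero = solve 1 (λ q → (:1 :- q :* :1) :* (:1 :+ (q :* :1) :* :0) := (:1 :- q :* :1) :* :1) refl q
  qbinom-suc-both zero (suc k) = solve 2 (λ q A → (:1 :- q :* A) :* (:0 :+ (q :* A) :* :0) := (:1 :- q :* :1) :* :0) refl q (pow q (suc k))
  qbinom-suc-both (suc n) zero = qbinom-suc-lower zero (suc (suc n))
  qbinom-suc-both (suc n) (suc k) = begin
    (1# - q * A) * ((F₀ + A * F₁) + (q * A) * G)
      ≈⟨ solve 5 (λ q A F₀ F₁ G → (:1 :- q :* A) :* ((F₀ :+ A :* F₁) :+ (q :* A) :* G)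
                    := (:1 :- q :* A) :* (F₀ :+ A :* F₁) :+ (q :* A) :* ((:1 :- q :* A) :* G)) refl q A F₀ F₁ G ⟩
    (1# - q * A) * (F₀ + A * F₁) + (q * A) * ((1# - q * A) * G)
      ≈⟨ +-congˡ (*-congˡ (qbinom-suc-both n (suc k))) ⟩
    (1# - q * A) * (F₀ + A * F₁) + (q * A) * ((1# - q * Pn) * F₁)
      ≈⟨ solve 5 (λ q Pk Pn F₀ F₁ → (:1 :- q :* (q :* Pk)) :* (F₀ :+ (q :* Pk) :* F₁) :+ (q :* (q :* Pk)) :* ((:1 :- q :* Pn) :* F₁)
            := (:1 :- q :* (q :* Pn)) :* (F₀ :+ (q :* Pk) :* F₁) :- q :* (q :* ((Pk :- Pn) :* F₀)) :+ q :* (q :* (Pk :* (:1 :- q :* Pk) :* F₁)))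
            refl q Pk Pn F₀ F₁ ⟩
    (1# - q * Nn) * (F₀ + A * F₁) - q * (q * ((Pk - Pn) * F₀)) + q * (q * (Pk * (1# - A) * F₁))
      ≈⟨ +-congʳ (+-congˡ (-‿cong (*-congˡ (*-congˡ (qbinom-suc-lower′ n k))))) ⟩
    (1# - q * Nn) * (F₀ + A * F₁) - q * (q * (Pk * (1# - A) * F₁)) + q * (q * (Pk * (1# - A) * F₁))
      ≈⟨ solve 2 (λ X W → X :- W :+ W := X) refl _ _ ⟩
    (1# - q * Nn) * (F₀ + A * F₁) ∎
    where
    Pk = pow q k
    Pn = pow q n
    A  = pow q (suc k)
    Nn = pow q (suc n)
    F₀ = qb n k
    F₁ = qb n (suc k)
    G  = qb (suc n) (suc (suc k))

-- A vector |v⟩ is represented by its moments j ↦ ⟨W|Dʲ|v⟩, where ⟨W|E = a⟨W|. In normal order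
-- DʲE = Σₖ pₖ E Dᵏ + Σₖ rₖ Dᵏ; ePart j v = Σₖ pₖ ⟨W|Dᵏ|v⟩ and dPart j v = Σₖ rₖ ⟨W|Dᵏ|v⟩, whose
-- recursions come from D·EDᵏ = qEDᵏ⁺¹ + Dᵏ⁺¹ + EDᵏ, so that Ê below is the action of E on moments.
module Moments {c ℓ : Level} (R : CommutativeRing c ℓ) (a q : CommutativeRing.Carrier R) where
  open CommutativeRing R hiding (zero)
  open Ops R
  open IntegerCoefficientSolver R
  open Sums R
  open import Relation.Binary.Reasoning.Setoid setoid

  Vect : Set c
  Vect = ℕ → Carrier

  infix 4 _≋_
  _≋_ : Vect → Vect → Set ℓ
  g ≋ h = ∀ j → g j ≈ h j

  ePart : ℕ → Vect → Carrier
  ePart zero    g = g 0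
  ePart (suc j) g = q * ePart j (g ∘ suc) + ePart j g

  dPart : ℕ → Vect → Carrier
  dPart zero    g = 0#
  dPart (suc j) g = dPart j (g ∘ suc) + ePart j (g ∘ suc)

  Ê : Vect → Vect
  Ê g j = a * ePart j g + dPart j g

  ⟪_⟫ : Vect → Term → Carrier
  ⟪ g ⟫ (x , i , k) = x * pow a i * g k

  eValue dValue : Vect → Term → Carrier
  eValue g (x , zero  , k) = 0#
  eValue g (x , suc _ , k) = x * g k
  dValue g (x , zero  , k) = x * g k
  dValue g (x , suc _ , k) = 0#

  ePart-DpowE : ∀ j g → sumList (eValue g) (DpowE q j) ≈ ePart j g
  ePart-step  : ∀ j g → sumList (λ t → q * eValue (g ∘ suc) t + eValue g t) (DpowE q j) ≈ ePart (suc j) g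

  ePart-DpowE zero    g = trans (+-identityʳ _) (*-identityˡ _)
  ePart-DpowE (suc j) g = begin
    sumList (eValue g) (DpowE q (suc j))
      ≈⟨ sumList-concatMap-cong (eValue g) _ (DpowE q j) (λ
           { (x , zero  , k) → solve 1 (λ q → :0 :+ :0 := q :* :0 :+ :0) refl q
           ; (x , suc _ , k) → solve 4 (λ q x G₁ G₀ → (q :* x) :* G₁ :+ (:0 :+ (x :* G₀ :+ :0)) := q :* (x :* G₁) :+ x :* G₀) refl q x (g (suc k)) (g k) }) ⟩
    sumList (λ t → q * eValue (g ∘ suc) t + eValue g t) (DpowE q j)
      ≈⟨ ePart-step j g ⟩
    ePart (suc j) g ∎

  ePart-step j g = begin
    sumList (λ t → q * eValue (g ∘ suc) t + eValue g t) (DpowE q j)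
      ≈⟨ trans (sumList-distrib-+ _ _ (DpowE q j)) (+-congʳ (sym (*-distribˡ-sumList q _ (DpowE q j)))) ⟩
    q * sumList (eValue (g ∘ suc)) (DpowE q j) + sumList (eValue g) (DpowE q j)
      ≈⟨ +-cong (*-congˡ (ePart-DpowE j (g ∘ suc))) (ePart-DpowE j g) ⟩
    ePart (suc j) g ∎

  dPart-step : ∀ j g → sumList (λ t → dValue (g ∘ suc) t + eValue (g ∘ suc) t) (DpowE q j) ≈ dPart (suc j) g
  dPart-DpowE : ∀ j g → sumList (dValue g) (DpowE q j) ≈ dPart j g

  dPart-step j g = trans (sumList-distrib-+ _ _ (DpowE q j)) (+-cong (dPart-DpowE j (g ∘ suc)) (ePart-DpowE j (g ∘ suc)))

  dPart-DpowE zero    g = +-identityʳ _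
  dPart-DpowE (suc j) g = begin
    sumList (dValue g) (DpowE q (suc j))
      ≈⟨ sumList-concatMap-cong (dValue g) _ (DpowE q j) (λ
           { (x , zero  , k) → refl
           ; (x , suc _ , k) → solve 2 (λ x G → :0 :+ (x :* G :+ (:0 :+ :0)) := :0 :+ x :* G) refl x (g (suc k)) }) ⟩
    sumList (λ t → dValue (g ∘ suc) t + eValue (g ∘ suc) t) (DpowE q j)
      ≈⟨ dPart-step j g ⟩
    dPart (suc j) g ∎

  DpowE-value : ∀ j g → sumList ⟪ g ⟫ (DpowE q j) ≈ Ê g j
  DpowE-value zero    g = solve 2 (λ a G → :1 :* (a :* :1) :* G :+ :0 := a :* G :+ :0) refl a (g 0)
  DpowE-value (suc j) g = begin
    sumList ⟪ g ⟫ (DpowE q (suc j))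
      ≈⟨ sumList-concatMap-cong ⟪ g ⟫ _ (DpowE q j) (λ
           { (x , zero  , k) → solve 4 (λ q x a G → x :* :1 :* G :+ :0 := a :* (q :* :0 :+ :0) :+ (x :* G :+ :0)) refl q x a (g (suc k))
           ; (x , suc _ , k) → solve 5 (λ q x a G₁ G₀ →
               (q :* x) :* (a :* :1) :* G₁ :+ (x :* :1 :* G₁ :+ (x :* (a :* :1) :* G₀ :+ :0))
                 := a :* (q :* (x :* G₁) :+ x :* G₀) :+ (:0 :+ x :* G₁)) refl q x a (g (suc k)) (g k) }) ⟩
    sumList (λ t → a * (q * eValue (g ∘ suc) t + eValue g t) + (dValue (g ∘ suc) t + eValue (g ∘ suc) t)) (DpowE q j)
      ≈⟨ trans (sumList-distrib-+ _ _ (DpowE q j)) (+-congʳ (sym (*-distribˡ-sumList a _ (DpowE q j)))) ⟩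
    a * sumList (λ t → q * eValue (g ∘ suc) t + eValue g t) (DpowE q j) + sumList (λ t → dValue (g ∘ suc) t + eValue (g ∘ suc) t) (DpowE q j)
      ≈⟨ +-cong (*-congˡ (ePart-step j g)) (dPart-step j g) ⟩
    Ê g (suc j) ∎

  lc : Carrier → Vect → Carrier → Vect → Vect
  lc u g v h j = u * g j + v * h j

  Congruent : (Vect → Vect) → Set (c Level.⊔ ℓ)
  Congruent T = ∀ {g h} → g ≋ h → T g ≋ T h

  Linear : (Vect → Vect) → Set (c Level.⊔ ℓ)
  Linear T = ∀ u g v h → T (lc u g v h) ≋ lc u (T g) v (T h)

  ePart-cong : ∀ j {g h} → g ≋ h → ePart j g ≈ ePart j h
  ePart-cong zero    g≋h = g≋h 0
  ePart-cong (suc j) g≋h = +-cong (*-congˡ (ePart-cong j (g≋h ∘ suc))) (ePart-cong j g≋h)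

  dPart-cong : ∀ j {g h} → g ≋ h → dPart j g ≈ dPart j h
  dPart-cong zero    g≋h = refl
  dPart-cong (suc j) g≋h = +-cong (dPart-cong j (g≋h ∘ suc)) (ePart-cong j (g≋h ∘ suc))

  ePart-lc : ∀ j u g v h → ePart j (lc u g v h) ≈ u * ePart j g + v * ePart j h
  ePart-lc zero    u g v h = refl
  ePart-lc (suc j) u g v h = trans (+-cong (*-congˡ (ePart-lc j u (g ∘ suc) v (h ∘ suc))) (ePart-lc j u g v h))
    (solve 7 (λ q u v A B C D → q :* (u :* A :+ v :* B) :+ (u :* C :+ v :* D) := u :* (q :* A :+ C) :+ v :* (q :* B :+ D)) refl q u v _ _ _ _)

  dPart-lc : ∀ j u g v h → dPart j (lc u g v h) ≈ u * dPart j g + v * dPart j h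
  dPart-lc zero    u g v h = solve 2 (λ u v → :0 := u :* :0 :+ v :* :0) refl u v
  dPart-lc (suc j) u g v h = trans (+-cong (dPart-lc j u (g ∘ suc) v (h ∘ suc)) (ePart-lc j u (g ∘ suc) v (h ∘ suc)))
    (solve 6 (λ u v A B C D → (u :* A :+ v :* B) :+ (u :* C :+ v :* D) := u :* (A :+ C) :+ v :* (B :+ D)) refl u v _ _ _ _)

  Ê-cong : Congruent Ê
  Ê-cong g≋h j = +-cong (*-congˡ (ePart-cong j g≋h)) (dPart-cong j g≋h)

  Ê-linear : Linear Ê
  Ê-linear u g v h j = trans (+-cong (*-congˡ (ePart-lc j u g v h)) (dPart-lc j u g v h))
    (solve 7 (λ a u v A B C D → a :* (u :* A :+ v :* B) :+ (u :* C :+ v :* D) := u :* (a :* A :+ C) :+ v :* (a :* B :+ D)) refl a u v _ _ _ _)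

  ePart-shift : ∀ j g → ePart j (g ∘ suc) + (1# - q) * dPart j (g ∘ suc) ≈ g (suc j) + dPart j g
  ePart-shift zero    g = solve 2 (λ G q → G :+ (:1 :- q) :* :0 := G :+ :0) refl (g 1) q
  ePart-shift (suc j) g = begin
    (q * ePart j (g ∘ suc ∘ suc) + ePart j (g ∘ suc)) + (1# - q) * (dPart j (g ∘ suc ∘ suc) + ePart j (g ∘ suc ∘ suc))
      ≈⟨ solve 4 (λ q P₂ P₁ Q₂ → (q :* P₂ :+ P₁) :+ (:1 :- q) :* (Q₂ :+ P₂) := (P₂ :+ (:1 :- q) :* Q₂) :+ P₁) refl q _ _ _ ⟩
    (ePart j (g ∘ suc ∘ suc) + (1# - q) * dPart j (g ∘ suc ∘ suc)) + ePart j (g ∘ suc) ≈⟨ +-congʳ (ePart-shift j (g ∘ suc)) ⟩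
    (g (suc (suc j)) + dPart j (g ∘ suc)) + ePart j (g ∘ suc)                           ≈⟨ +-assoc _ _ _ ⟩
    g (suc (suc j)) + (dPart j (g ∘ suc) + ePart j (g ∘ suc))                           ∎

  -- D(E v) = q E(D v) + D v + E v, the relation DE - qED = D + E read on moments
  Ê-commute : ∀ g j → Ê g (suc j) ≈ q * Ê (g ∘ suc) j + g (suc j) + Ê g j
  Ê-commute g j = begin
    a * (q * P₁ + P₀) + (Q₁ + P₁)
      ≈⟨ solve 5 (λ a q P₁ P₀ Q₁ → a :* (q :* P₁ :+ P₀) :+ (Q₁ :+ P₁) := q :* (a :* P₁ :+ Q₁) :+ (P₁ :+ (:1 :- q) :* Q₁) :+ a :* P₀) refl a q P₁ P₀ Q₁ ⟩
    q * (a * P₁ + Q₁) + (P₁ + (1# - q) * Q₁) + a * P₀ ≈⟨ +-congʳ (+-congˡ (ePart-shift j g)) ⟩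
    q * (a * P₁ + Q₁) + (g (suc j) + dPart j g) + a * P₀
      ≈⟨ solve 7 (λ a q P₁ Q₁ G Q₀ P₀ → q :* (a :* P₁ :+ Q₁) :+ (G :+ Q₀) :+ a :* P₀
                    := q :* (a :* P₁ :+ Q₁) :+ G :+ (a :* P₀ :+ Q₀)) refl a q P₁ Q₁ (g (suc j)) (dPart j g) P₀ ⟩
    q * Ê (g ∘ suc) j + g (suc j) + Ê g j ∎
    where
    P₁ = ePart j (g ∘ suc)
    P₀ = ePart j g
    Q₁ = dPart j (g ∘ suc)

  linear-scale : ∀ {T} → Linear T → Congruent T → ∀ u g → T (λ j → u * g j) ≋ (λ j → u * T g j)
  linear-scale {T} T-linear T-cong u g j = begin
    T (λ j → u * g j) j      ≈⟨ T-cong (λ k → solve 2 (λ u G → u :* G := u :* G :+ :0 :* G) refl u (g k)) j ⟩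
    T (lc u g 0# g) j        ≈⟨ T-linear u g 0# g j ⟩
    u * T g j + 0# * T g j   ≈⟨ solve 2 (λ u G → u :* G :+ :0 :* G := u :* G) refl u (T g j) ⟩
    u * T g j                ∎

  linear-sumTo : ∀ {T} → Linear T → Congruent T → ∀ n (w : ℕ → Carrier) (v : ℕ → Vect) →
                 T (λ j → sumTo n (λ k → w k * v k j)) ≋ (λ j → sumTo n (λ k → w k * T (v k) j))
  linear-sumTo T-linear T-cong zero    w v = linear-scale T-linear T-cong (w 0) (v 0)
  linear-sumTo {T} T-linear T-cong (suc n) w v j = begin
    T (λ j → S j + w (suc n) * v (suc n) j) j   ≈⟨ T-cong (λ k → +-congʳ (sym (*-identityˡ (S k)))) j ⟩
    T (lc 1# S (w (suc n)) (v (suc n))) j       ≈⟨ T-linear 1# S (w (suc n)) (v (suc n)) j ⟩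
    1# * T S j + w (suc n) * T (v (suc n)) j    ≈⟨ +-congʳ (trans (*-identityˡ _) (linear-sumTo T-linear T-cong n w v j)) ⟩
    sumTo n (λ k → w k * T (v k) j) + w (suc n) * T (v (suc n)) j ∎
    where
    S : Vect
    S j = sumTo n (λ k → w k * v k j)

fold-shift : ∀ {a} {A : Set a} (x : A) (f : A → A) n → fold (f x) f n ≡ fold x f (suc n)
fold-shift x f zero    = ≡.refl
fold-shift x f (suc n) = ≡.cong f (fold-shift x f n)

module CoefficientRecursion {c ℓ : Level} (R : CommutativeRing c ℓ) (y q : CommutativeRing.Carrier R) where
  open CommutativeRing R hiding (zero)
  open Ops R using (pow)

  κ : ℕ → Carrier
  κ n = y * (1# - pow q n)

  atPred : (ℕ → Carrier) → ℕ → Carrier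
  atPred f zero    = 0#
  atPred f (suc n) = f n

  record Recursive (Rc : ℕ → ℕ → Carrier) : Set ℓ where
    field
      initial : Rc 0 0 ≈ 1#
      vanish  : ∀ N n → N < n → Rc N n ≈ 0#
      step    : ∀ N n → Rc (suc N) n ≈ (1# + y) * Rc N n + atPred (Rc N) n + κ (suc n) * Rc N (suc n)

module PartitionFunction {c ℓ : Level} (R : CommutativeRing c ℓ) (a b y q : CommutativeRing.Carrier R) where
  open CommutativeRing R hiding (zero)
  open Ops R
  open IntegerCoefficientSolver R
  open Sums R
  open Moments R a q
  open QBinomial R q
  open CoefficientRecursion R y q
  open import Relation.Binary.Reasoning.Setoid setoid

  X : Vect → Vect
  X g j = y * g (suc j) + Ê g j

  V : Vect
  V = pow b

  mulYDE-value : ∀ g ts → sumList ⟪ g ⟫ (mulYDE y q ts) ≈ sumList ⟪ X g ⟫ ts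
  mulYDE-value g ts = sumList-concatMap-cong ⟪ g ⟫ _ ts λ { (x , i , j) → begin
    (y * x) * pow a i * g (suc j) + sumList ⟪ g ⟫ (mulE q (x , i , j))
      ≈⟨ +-congˡ (sumList-map ⟪ g ⟫ _ (DpowE q j)) ⟩
    (y * x) * pow a i * g (suc j) + sumList (λ { (x′ , e , k) → (x * x′) * pow a (i ℕ.+ e) * g k }) (DpowE q j)
      ≈⟨ +-congˡ (sumList-cong (DpowE q j) λ { (x′ , e , k) → trans (*-congʳ (*-congˡ (pow-+ a i e)))
            (solve 5 (λ x x′ A B G → (x :* x′) :* (A :* B) :* G := (x :* A) :* (x′ :* B :* G)) refl x x′ (pow a i) (pow a e) (g k)) }) ⟩
    (y * x) * pow a i * g (suc j) + sumList (λ t → (x * pow a i) * ⟪ g ⟫ t) (DpowE q j)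
      ≈⟨ +-congˡ (sym (*-distribˡ-sumList _ ⟪ g ⟫ (DpowE q j))) ⟩
    (y * x) * pow a i * g (suc j) + (x * pow a i) * sumList ⟪ g ⟫ (DpowE q j)
      ≈⟨ +-congˡ (*-congˡ (DpowE-value j g)) ⟩
    (y * x) * pow a i * g (suc j) + (x * pow a i) * Ê g j
      ≈⟨ solve 5 (λ y x A G E → (y :* x) :* A :* G :+ (x :* A) :* E := x :* A :* (y :* G :+ E)) refl y x (pow a i) (g (suc j)) (Ê g j) ⟩
    x * pow a i * X g j ∎ }

  powYDE-value : ∀ N g → sumList ⟪ g ⟫ (powYDE y q N) ≈ fold g X N 0
  powYDE-value zero    g = solve 1 (λ G → :1 :* :1 :* G :+ :0 := G) refl (g 0)
  powYDE-value (suc N) g = begin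
    sumList ⟪ g ⟫ (mulYDE y q (powYDE y q N)) ≈⟨ mulYDE-value g (powYDE y q N) ⟩
    sumList ⟪ X g ⟫ (powYDE y q N)            ≈⟨ powYDE-value N (X g) ⟩
    fold (X g) X N 0                          ≡⟨ ≡.cong (λ h → h 0) (fold-shift g X N) ⟩
    fold g X (suc N) 0                        ∎

  Z≈X^N[V] : ∀ N → Z N a b y q ≈ fold V X N 0
  Z≈X^N[V] N = powYDE-value N V

  t : Carrier
  t = 1# - q

  d̂ ê Y : Vect → Vect
  d̂ g j = t * g (suc j) - g j
  ê g j = t * Ê g j - g j
  Y g j = (1# + y) * g j + y * d̂ g j + ê g j

  d̂-cong : Congruent d̂
  d̂-cong g≋h j = +-cong (*-congˡ (g≋h (suc j))) (-‿cong (g≋h j))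

  ê-cong : Congruent ê
  ê-cong g≋h j = +-cong (*-congˡ (Ê-cong g≋h j)) (-‿cong (g≋h j))

  Y-cong : Congruent Y
  Y-cong g≋h j = +-cong (+-cong (*-congˡ (g≋h j)) (*-congˡ (d̂-cong g≋h j))) (ê-cong g≋h j)

  d̂-linear : Linear d̂
  d̂-linear u g v h j = solve 7 (λ t u v A B C D → t :* (u :* A :+ v :* B) :- (u :* C :+ v :* D)
                                                 := u :* (t :* A :- C) :+ v :* (t :* B :- D)) refl t u v _ _ _ _

  ê-linear : Linear ê
  ê-linear u g v h j = trans (+-congʳ (*-congˡ (Ê-linear u g v h j)))
    (solve 7 (λ t u v A B C D → t :* (u :* A :+ v :* B) :- (u :* C :+ v :* D) := u :* (t :* A :- C) :+ v :* (t :* B :- D)) refl t u v _ _ _ _)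

  Y-linear : Linear Y
  Y-linear u g v h j = trans (+-cong (+-congˡ (*-congˡ (d̂-linear u g v h j))) (ê-linear u g v h j))
    (solve 9 (λ y u v A B C D E F → (:1 :+ y) :* (u :* A :+ v :* B) :+ y :* (u :* C :+ v :* D) :+ (u :* E :+ v :* F)
                := u :* ((:1 :+ y) :* A :+ y :* C :+ E) :+ v :* ((:1 :+ y) :* B :+ y :* D :+ F)) refl y u v _ _ _ _ _ _)

  Y≈t·X : ∀ g j → Y g j ≈ t * X g j
  Y≈t·X g j = solve 5 (λ y q G₁ G₀ E → (:1 :+ y) :* G₀ :+ y :* ((:1 :- q) :* G₁ :- G₀) :+ ((:1 :- q) :* E :- G₀)
                                       := (:1 :- q) :* (y :* G₁ :+ E)) refl y q (g (suc j)) (g j) (Ê g j)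

  Y^N≈t^N·X^N : ∀ N g j → fold g Y N j ≈ pow t N * fold g X N j
  Y^N≈t^N·X^N zero    g j = sym (*-identityˡ _)
  Y^N≈t^N·X^N (suc N) g j = begin
    Y (fold g Y N) j                                ≈⟨ Y-cong (Y^N≈t^N·X^N N g) j ⟩
    Y (λ k → pow t N * fold g X N k) j              ≈⟨ linear-scale Y-linear Y-cong (pow t N) (fold g X N) j ⟩
    pow t N * Y (fold g X N) j                      ≈⟨ *-congˡ (Y≈t·X (fold g X N) j) ⟩
    pow t N * (t * X (fold g X N) j)                ≈⟨ solve 3 (λ A B C → A :* (B :* C) := (B :* A) :* C) refl _ _ _ ⟩
    pow t (suc N) * fold g X (suc N) j              ∎

  d̂ê-commute : ∀ g j → d̂ (ê g) j ≈ q * ê (d̂ g) j + t * g j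
  d̂ê-commute g j = begin
    t * (t * Ê g (suc j) - g (suc j)) - (t * Ê g j - g j)
      ≈⟨ +-congʳ (*-congˡ (+-congʳ (*-congˡ (Ê-commute g j)))) ⟩
    t * (t * (q * Ê (g ∘ suc) j + g (suc j) + Ê g j) - g (suc j)) - (t * Ê g j - g j)
      ≈⟨ solve 5 (λ q B G₁ E₀ G₀ → (:1 :- q) :* ((:1 :- q) :* (q :* B :+ G₁ :+ E₀) :- G₁) :- ((:1 :- q) :* E₀ :- G₀)
           := q :* ((:1 :- q) :* ((:1 :- q) :* B :- E₀) :- ((:1 :- q) :* G₁ :- G₀)) :+ (:1 :- q) :* G₀)
           refl q (Ê (g ∘ suc) j) (g (suc j)) (Ê g j) (g j) ⟩
    q * (t * (t * Ê (g ∘ suc) j - Ê g j) - d̂ g j) + t * g j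
      ≈⟨ +-congʳ (*-congˡ (+-congʳ (*-congˡ (sym Ê[d̂g])))) ⟩
    q * ê (d̂ g) j + t * g j ∎
    where
    Ê[d̂g] : Ê (d̂ g) j ≈ t * Ê (g ∘ suc) j - Ê g j
    Ê[d̂g] = begin
      Ê (d̂ g) j
        ≈⟨ Ê-cong (λ k → solve 3 (λ t A B → t :* A :- B := t :* A :+ (:- :1) :* B) refl t (g (suc k)) (g k)) j ⟩
      Ê (lc t (g ∘ suc) (- 1#) g) j
        ≈⟨ Ê-linear t (g ∘ suc) (- 1#) g j ⟩
      t * Ê (g ∘ suc) j + (- 1#) * Ê g j
        ≈⟨ solve 3 (λ t A B → t :* A :+ (:- :1) :* B := t :* A :- B) refl t _ _ ⟩
      t * Ê (g ∘ suc) j - Ê g j ∎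

  α̃ β̃ w : Carrier
  α̃ = tilde q a
  β̃ = tilde q b
  w = y * β̃

  u : ℕ → Vect
  u = fold V ê

  d̂V : ∀ j → d̂ V j ≈ β̃ * V j
  d̂V j = solve 3 (λ q b B → (:1 :- q) :* (b :* B) :- B := ((:1 :- q) :* b :- :1) :* B) refl q b (pow b j)

  d̂u : ∀ k j → d̂ (u k) j ≈ (pow q k * β̃) * u k j + (1# - pow q k) * u (k ∸ 1) j
  d̂u zero    j = trans (d̂V j) (solve 2 (λ β B → β :* B := (:1 :* β) :* B :+ (:1 :- :1) :* B) refl β̃ (V j))
  d̂u (suc k) j = begin
    d̂ (ê (u k)) j                                                                 ≈⟨ d̂ê-commute (u k) j ⟩
    q * ê (d̂ (u k)) j + t * u k j                                                 ≈⟨ +-congʳ (*-congˡ (ê-cong (d̂u k) j)) ⟩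
    q * ê (lc (pow q k * β̃) (u k) (1# - pow q k) (u (k ∸ 1))) j + t * u k j       ≈⟨ +-congʳ (*-congˡ (ê-linear _ _ _ _ j)) ⟩
    q * ((pow q k * β̃) * u (suc k) j + (1# - pow q k) * ê (u (k ∸ 1)) j) + t * u k j ≈⟨ regroup k ⟩
    (pow q (suc k) * β̃) * u (suc k) j + (1# - pow q (suc k)) * u k j              ∎
    where
    regroup : ∀ k → q * ((pow q k * β̃) * u (suc k) j + (1# - pow q k) * ê (u (k ∸ 1)) j) + t * u k j ≈
                    (pow q (suc k) * β̃) * u (suc k) j + (1# - pow q (suc k)) * u k j
    regroup zero    = solve 5 (λ q β U₁ W U₀ → q :* ((:1 :* β) :* U₁ :+ (:1 :- :1) :* W) :+ (:1 :- q) :* U₀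
                        := (q :* :1 :* β) :* U₁ :+ (:1 :- q :* :1) :* U₀) refl q β̃ (u 1 j) (ê (u 0) j) (u 0 j)
    regroup (suc k) = solve 5 (λ q Q β U₁ U₀ → q :* ((Q :* β) :* U₁ :+ (:1 :- Q) :* U₀) :+ (:1 :- q) :* U₀
                        := (q :* Q :* β) :* U₁ :+ (:1 :- q :* Q) :* U₀) refl q (pow q (suc k)) β̃ (u (suc (suc k)) j) (u (suc k) j)

  hCoeff : ℕ → ℕ → Carrier
  hCoeff n k = qb n k * pow w (n ∸ k)

  h : ℕ → Vect
  h n j = sumTo n (λ k → hCoeff n k * u k j)

  -- the part of hₙ₊₁ coming from the q-Pascal term qᵏ [n k]_q
  hPascal : ℕ → ℕ → ℕ → Carrier
  hPascal n j k = pow q k * qb n k * pow w (suc n ∸ k) * u k j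

  h-suc : ∀ n j → h (suc n) j ≈ sumTo n (hPascal n j) + sumTo n (λ k → hCoeff n k * u (suc k) j)
  h-suc n j = begin
    sumTo (suc n) (λ k → hCoeff (suc n) k * u k j)  ≈⟨ sumTo-cong (suc n) split ⟩
    sumTo (suc n) (λ k → hPascal n j k + G k)        ≈⟨ sumTo-distrib-+ (suc n) _ _ ⟩
    sumTo (suc n) (hPascal n j) + sumTo (suc n) G    ≈⟨ +-cong (trans (+-congˡ top≈0) (+-identityʳ _)) (trans (sumTo-sucˡ n G) (+-identityˡ _)) ⟩
    sumTo n (hPascal n j) + sumTo n (λ k → hCoeff n k * u (suc k) j) ∎
    where
    G : ℕ → Carrier
    G zero    = 0#
    G (suc k) = hCoeff n k * u (suc k) j
    split : ∀ k → hCoeff (suc n) k * u k j ≈ hPascal n j k + G k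
    split zero    = solve 2 (λ W U → :1 :* W :* U := :1 :* :1 :* W :* U :+ :0) refl (pow w (suc n)) (u 0 j)
    split (suc k) = solve 5 (λ F₀ Q F₁ W U → (F₀ :+ Q :* F₁) :* W :* U := Q :* F₁ :* W :* U :+ F₀ :* W :* U)
                      refl (qb n k) (pow q (suc k)) (qb n (suc k)) (pow w (n ∸ k)) (u (suc k) j)
    top≈0 : hPascal n j (suc n) ≈ 0#
    top≈0 = begin
      pow q (suc n) * qb n (suc n) * pow w (n ∸ n) * u (suc n) j ≈⟨ *-congʳ (*-congʳ (*-congˡ (k>n⇒qbinom≈0 n (suc n) ℕₚ.≤-refl))) ⟩
      pow q (suc n) * 0# * pow w (n ∸ n) * u (suc n) j           ≈⟨ solve 3 (λ A B C → A :* :0 :* B :* C := :0) refl _ _ _ ⟩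
      0#                                                  ∎

  ê-h : ∀ n j → ê (h n) j ≈ sumTo n (λ k → hCoeff n k * u (suc k) j)
  ê-h n = linear-sumTo ê-linear ê-cong n (hCoeff n) u

  y·d̂-h : ∀ n j → y * d̂ (h n) j ≈ sumTo n (hPascal n j) + κ n * h (n ∸ 1) j
  y·d̂-h n j = begin
    y * d̂ (h n) j
      ≈⟨ *-congˡ (linear-sumTo d̂-linear d̂-cong n (hCoeff n) u j) ⟩
    y * sumTo n (λ k → hCoeff n k * d̂ (u k) j)
      ≈⟨ *-congˡ (trans (sumTo-cong n (λ k → trans (*-congˡ (d̂u k j)) (distribˡ _ _ _))) (sumTo-distrib-+ n _ _)) ⟩
    y * (sumTo n (λ k → hCoeff n k * ((pow q k * β̃) * u k j)) + sumTo n (λ k → hCoeff n k * ((1# - pow q k) * u (k ∸ 1) j)))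
      ≈⟨ distribˡ _ _ _ ⟩
    y * sumTo n (λ k → hCoeff n k * ((pow q k * β̃) * u k j)) + y * sumTo n (λ k → hCoeff n k * ((1# - pow q k) * u (k ∸ 1) j))
      ≈⟨ +-cong diagonal (lowering n) ⟩
    sumTo n (hPascal n j) + κ n * h (n ∸ 1) j ∎
    where
    diagonal : y * sumTo n (λ k → hCoeff n k * ((pow q k * β̃) * u k j)) ≈ sumTo n (hPascal n j)
    diagonal = trans (*-distribˡ-sumTo n y _) (sumTo-cong-≤ n λ k k≤n →
      ≡.subst (λ e → y * (qb n k * pow w (n ∸ k) * ((pow q k * β̃) * u k j)) ≈ pow q k * qb n k * pow w e * u k j)
        (≡.sym (ℕₚ.+-∸-assoc 1 k≤n))
        (solve 6 (λ y F Q β U Wn → y :* (F :* Wn :* ((Q :* β) :* U)) := Q :* F :* ((y :* β) :* Wn) :* U)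
           refl y (qb n k) (pow q k) β̃ (u k j) (pow w (n ∸ k))))
    lowering : ∀ n → y * sumTo n (λ k → hCoeff n k * ((1# - pow q k) * u (k ∸ 1) j)) ≈ κ n * h (n ∸ 1) j
    lowering zero    = solve 3 (λ y C U → y :* (C :* ((:1 :- :1) :* U)) := (y :* (:1 :- :1)) :* (C :* U)) refl y (hCoeff 0 0) (u 0 j)
    lowering (suc n) = begin
      y * sumTo (suc n) G                                      ≈⟨ *-congˡ (sumTo-sucˡ n G) ⟩
      y * (G 0 + sumTo n (G ∘ suc))                            ≈⟨ *-congˡ (+-cong G0≈0 (sumTo-cong n absorb)) ⟩
      y * (0# + sumTo n (λ k → (1# - pow q (suc n)) * (hCoeff n k * u k j)))
        ≈⟨ *-congˡ (trans (+-identityˡ _) (sym (*-distribˡ-sumTo n _ _))) ⟩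
      y * ((1# - pow q (suc n)) * h n j)                       ≈⟨ *-assoc _ _ _ ⟨
      κ (suc n) * h n j                       ∎
      where
      G : ℕ → Carrier
      G k = hCoeff (suc n) k * ((1# - pow q k) * u (k ∸ 1) j)
      G0≈0 : G 0 ≈ 0#
      G0≈0 = solve 2 (λ C U → C :* ((:1 :- :1) :* U) := :0) refl (hCoeff (suc n) 0) (u 0 j)
      absorb : ∀ k → G (suc k) ≈ (1# - pow q (suc n)) * (hCoeff n k * u k j)
      absorb k = begin
        qb (suc n) (suc k) * pow w (n ∸ k) * ((1# - pow q (suc k)) * u k j)
          ≈⟨ solve 4 (λ F W A U → F :* W :* (A :* U) := (A :* F) :* (W :* U)) refl _ _ _ _ ⟩
        ((1# - pow q (suc k)) * qb (suc n) (suc k)) * (pow w (n ∸ k) * u k j) ≈⟨ *-congʳ (qbinom-suc-both n k) ⟩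
        ((1# - pow q (suc n)) * qb n k) * (pow w (n ∸ k) * u k j)
          ≈⟨ solve 4 (λ A F W U → (A :* F) :* (W :* U) := A :* (F :* W :* U)) refl _ _ _ _ ⟩
        (1# - pow q (suc n)) * (hCoeff n k * u k j) ∎

  Y-h : ∀ n j → Y (h n) j ≈ (1# + y) * h n j + h (suc n) j + κ n * h (n ∸ 1) j
  Y-h n j = begin
    (1# + y) * h n j + y * d̂ (h n) j + ê (h n) j
      ≈⟨ +-cong (+-congˡ (y·d̂-h n j)) (ê-h n j) ⟩
    (1# + y) * h n j + (sumTo n (hPascal n j) + L) + S
      ≈⟨ solve 4 (λ H P L S → H :+ (P :+ L) :+ S := H :+ (P :+ S) :+ L) refl _ _ _ _ ⟩
    (1# + y) * h n j + (sumTo n (hPascal n j) + S) + L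
      ≈⟨ +-congʳ (+-congˡ (h-suc n j)) ⟨
    (1# + y) * h n j + h (suc n) j + κ n * h (n ∸ 1) j ∎
    where
    L = κ n * h (n ∸ 1) j
    S = sumTo n (λ k → hCoeff n k * u (suc k) j)

  u-at-0 : ∀ k → u k 0 ≈ pow α̃ k
  u-at-0 zero    = refl
  u-at-0 (suc k) = trans (solve 3 (λ t a U → t :* (a :* U :+ :0) :- U := (t :* a :- :1) :* U) refl t a (u k 0)) (*-congˡ (u-at-0 k))

  h-at-0 : ∀ n → h n 0 ≈ Bpoly n α̃ β̃ y q
  h-at-0 n = sumTo-cong n (λ k → trans (*-congˡ (u-at-0 k))
    (solve 3 (λ F W A → F :* W :* A := F :* A :* W) refl (qb n k) (pow w (n ∸ k)) (pow α̃ k)))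

  Y-on-h : ∀ N (r : ℕ → Carrier) → (∀ n → N < n → r n ≈ 0#) → ∀ j →
           Y (λ j → sumTo N (λ n → r n * h n j)) j
             ≈ sumTo (suc N) (λ n → ((1# + y) * r n + atPred r n + κ (suc n) * r (suc n)) * h n j)
  Y-on-h N r r-vanish j = begin
    Y (λ j → sumTo N (λ n → r n * h n j)) j
      ≈⟨ linear-sumTo Y-linear Y-cong N r h j ⟩
    sumTo N (λ n → r n * Y (h n) j)
      ≈⟨ sumTo-cong N (λ n → trans (*-congˡ (Y-h n j)) (solve 4 (λ R A B C → R :* (A :+ B :+ C) := R :* A :+ R :* B :+ R :* C) refl _ _ _ _)) ⟩
    sumTo N (λ n → r n * ((1# + y) * h n j) + r n * h (suc n) j + r n * (κ n * h (n ∸ 1) j))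
      ≈⟨ trans (sumTo-distrib-+ N _ _) (+-congʳ (sumTo-distrib-+ N _ _)) ⟩
    sumTo N (λ n → r n * ((1# + y) * h n j)) + sumTo N (λ n → r n * h (suc n) j) + sumTo N (λ n → r n * (κ n * h (n ∸ 1) j))
      ≈⟨ +-cong (+-cong stay raise) lower ⟩
    sumTo (suc N) (λ n → (1# + y) * r n * h n j) + sumTo (suc N) (λ n → atPred r n * h n j) + sumTo (suc N) (λ n → κ (suc n) * r (suc n) * h n j)
      ≈⟨ sym (trans (sumTo-distrib-+ (suc N) _ _) (+-congʳ (sumTo-distrib-+ (suc N) _ _))) ⟩
    sumTo (suc N) (λ n → (1# + y) * r n * h n j + atPred r n * h n j + κ (suc n) * r (suc n) * h n j)
      ≈⟨ sumTo-cong (suc N) (λ n → solve 6 (λ A R P C R′ H → A :* R :* H :+ P :* H :+ C :* R′ :* H := (A :* R :+ P :+ C :* R′) :* H)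
                                             refl (1# + y) (r n) (atPred r n) (κ (suc n)) (r (suc n)) (h n j)) ⟩
    sumTo (suc N) (λ n → ((1# + y) * r n + atPred r n + κ (suc n) * r (suc n)) * h n j) ∎
    where
    r[n]*≈0 : ∀ n → N < n → ∀ x → r n * x ≈ 0#
    r[n]*≈0 n N<n x = trans (*-congʳ (r-vanish n N<n)) (zeroˡ x)
    stay : sumTo N (λ n → r n * ((1# + y) * h n j)) ≈ sumTo (suc N) (λ n → (1# + y) * r n * h n j)
    stay = begin
      sumTo N (λ n → r n * ((1# + y) * h n j))       ≈⟨ sumTo-extend (suc N) (ℕₚ.n≤1+n N) (λ n N<n → r[n]*≈0 n N<n _) ⟨
      sumTo (suc N) (λ n → r n * ((1# + y) * h n j)) ≈⟨ sumTo-cong (suc N) (λ n → solve 3 (λ R A H → R :* (A :* H) := A :* R :* H) refl _ _ _) ⟩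
      sumTo (suc N) (λ n → (1# + y) * r n * h n j)   ∎
    raise : sumTo N (λ n → r n * h (suc n) j) ≈ sumTo (suc N) (λ n → atPred r n * h n j)
    raise = sym (trans (sumTo-sucˡ N _) (trans (+-congʳ (zeroˡ _)) (+-identityˡ _)))
    lower : sumTo N (λ n → r n * (κ n * h (n ∸ 1) j)) ≈ sumTo (suc N) (λ n → κ (suc n) * r (suc n) * h n j)
    lower = begin
      sumTo N G                       ≈⟨ sumTo-extend (suc (suc N)) (ℕₚ.m≤n⇒m≤1+n (ℕₚ.n≤1+n N)) (λ n N<n → r[n]*≈0 n N<n _) ⟨
      sumTo (suc (suc N)) G           ≈⟨ sumTo-sucˡ (suc N) G ⟩
      G 0 + sumTo (suc N) (G ∘ suc)   ≈⟨ +-congʳ (solve 3 (λ R y H → R :* ((y :* (:1 :- :1)) :* H) := :0) refl (r 0) y (h 0 j)) ⟩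
      0# + sumTo (suc N) (G ∘ suc)    ≈⟨ +-identityˡ _ ⟩
      sumTo (suc N) (G ∘ suc)         ≈⟨ sumTo-cong (suc N) (λ n → solve 3 (λ R C H → R :* (C :* H) := C :* R :* H) refl _ _ _) ⟩
      sumTo (suc N) (λ n → κ (suc n) * r (suc n) * h n j) ∎
      where
      G : ℕ → Carrier
      G n = r n * (κ n * h (n ∸ 1) j)

  module _ {Rc : ℕ → ℕ → Carrier} (Rc-recursive : Recursive Rc) where
    open Recursive Rc-recursive

    Y^N[V]-expansion : ∀ N j → fold V Y N j ≈ sumTo N (λ n → Rc N n * h n j)
    Y^N[V]-expansion zero    j = sym (trans (*-cong initial (solve 1 (λ v → :1 :* :1 :* v := v) refl (V j))) (*-identityˡ _))
    Y^N[V]-expansion (suc N) j = begin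
      Y (fold V Y N) j                                ≈⟨ Y-cong (Y^N[V]-expansion N) j ⟩
      Y (λ j → sumTo N (λ n → Rc N n * h n j)) j      ≈⟨ Y-on-h N (Rc N) (vanish N) j ⟩
      sumTo (suc N) (λ n → ((1# + y) * Rc N n + atPred (Rc N) n + κ (suc n) * Rc N (suc n)) * h n j)
                                                      ≈⟨ sumTo-cong (suc N) (λ n → *-congʳ (sym (step N n))) ⟩
      sumTo (suc N) (λ n → Rc (suc N) n * h n j)      ∎

    pasep-expansion : ∀ N → pow t N * Z N a b y q ≈ sumTo N (λ n → Rc N n * Bpoly n α̃ β̃ y q)
    pasep-expansion N = begin
      pow t N * Z N a b y q                   ≈⟨ *-congˡ (Z≈X^N[V] N) ⟩
      pow t N * fold V X N 0                  ≈⟨ Y^N≈t^N·X^N N V 0 ⟨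
      fold V Y N 0                            ≈⟨ Y^N[V]-expansion N 0 ⟩
      sumTo N (λ n → Rc N n * h n 0)          ≈⟨ sumTo-cong N (λ n → *-congˡ (h-at-0 n)) ⟩
      sumTo N (λ n → Rc N n * Bpoly n α̃ β̃ y q) ∎

module Coefficients {c ℓ : Level} (R : CommutativeRing c ℓ) (y q : CommutativeRing.Carrier R) where
  open CommutativeRing R hiding (zero)
  open Ops R
  open IntegerCoefficientSolver R
  open Sums R
  open QBinomial R q
  open CoefficientRecursion R y q
  open import Relation.Binary.Reasoning.Setoid setoid

  binom binom₋ : ℕ → ℕ → Carrier
  binom  N k = fromℕ (N C k)
  binom₋ N k = fromℕ (binomPred N k)

  binom-vanish : ∀ N k → N < k → binom N k ≈ 0#
  binom-vanish N k N<k = reflexive (≡.cong fromℕ (k>n⇒nCk≡0 N<k))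

  binom-pascal : ∀ N k → binom (suc N) k ≈ binom N k + binom₋ N k
  binom-pascal N zero    = sym (+-identityʳ _)
  binom-pascal N (suc k) = trans (reflexive (≡.cong fromℕ (≡.sym (nCk+nC[k+1]≡[n+1]C[k+1] N k))))
                                 (trans (fromℕ-+ (N C k) (N C suc k)) (+-comm _ _))

  sumTo-binom₋ : ∀ N (X : ℕ → Carrier) → sumTo (suc N) (λ j → pow y j * (binom₋ N j * X j)) ≈ y * sumTo N (λ j → pow y j * (binom N j * X (suc j)))
  sumTo-binom₋ N X = begin
    sumTo (suc N) (λ j → pow y j * (binom₋ N j * X j))
      ≈⟨ sumTo-sucˡ N _ ⟩
    1# * (0# * X 0) + sumTo N (λ j → pow y (suc j) * (binom N j * X (suc j)))
      ≈⟨ +-cong (solve 1 (λ x → :1 :* (:0 :* x) := :0) refl (X 0)) (sumTo-cong N (λ j → *-assoc _ _ _)) ⟩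
    0# + sumTo N (λ j → y * (pow y j * (binom N j * X (suc j))))
      ≈⟨ trans (+-identityˡ _) (sym (*-distribˡ-sumTo N y _)) ⟩
    y * sumTo N (λ j → pow y j * (binom N j * X (suc j))) ∎

  crossSum : ℕ → ℕ → Carrier
  crossSum N m = sumTo N (λ j → pow y j * (binom N j * binom N (m ℕ.+ j)))

  *-zero-middleˡ : ∀ x {u} v → u ≈ 0# → x * (u * v) ≈ 0#
  *-zero-middleˡ x v u≈0 = trans (*-congˡ (trans (*-congʳ u≈0) (zeroˡ v))) (zeroʳ x)

  *-zero-middleʳ : ∀ x u {v} → v ≈ 0# → x * (u * v) ≈ 0#
  *-zero-middleʳ x u v≈0 = trans (*-congˡ (trans (*-congˡ v≈0) (zeroʳ u))) (zeroʳ x)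

  crossSum-extend : ∀ N B m → N ≤ B → sumTo B (λ j → pow y j * (binom N j * binom N (m ℕ.+ j))) ≈ crossSum N m
  crossSum-extend N B m N≤B = sumTo-extend B N≤B (λ k N<k → *-zero-middleˡ _ _ (binom-vanish N k N<k))

  crossSum-vanish : ∀ N m → N < m → crossSum N m ≈ 0#
  crossSum-vanish N m N<m = sumTo-zero N (λ k _ → *-zero-middleʳ _ _ (binom-vanish N (m ℕ.+ k) (ℕₚ.<-≤-trans N<m (ℕₚ.m≤m+n m k))))

  -- A_N(m - 1), using the symmetry A_N(-1) = y A_N(1)
  crossSumPred : ℕ → ℕ → Carrier
  crossSumPred N zero    = y * crossSum N 1
  crossSumPred N (suc m) = crossSum N m

  crossSum-step : ∀ N m → crossSum (suc N) m ≈ (1# + y) * crossSum N m + crossSumPred N m + y * crossSum N (suc m)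
  crossSum-step N m = begin
    sumTo (suc N) (λ j → pow y j * (binom (suc N) j * binom (suc N) (m ℕ.+ j)))
      ≈⟨ sumTo-cong (suc N) (λ j → trans (*-congˡ (*-cong (binom-pascal N j) (binom-pascal N (m ℕ.+ j))))
            (solve 5 (λ Y a b c d → Y :* ((a :+ b) :* (c :+ d)) := ((Y :* (a :* c) :+ Y :* (b :* d)) :+ Y :* (a :* d)) :+ Y :* (b :* c)) refl _ _ _ _ _)) ⟩
    sumTo (suc N) (λ j → ((S₁ j + S₂ j) + S₃ j) + S₄ j)
      ≈⟨ trans (sumTo-distrib-+ (suc N) _ _) (+-congʳ (trans (sumTo-distrib-+ (suc N) _ _) (+-congʳ (sumTo-distrib-+ (suc N) _ _)))) ⟩
    ((sumTo (suc N) S₁ + sumTo (suc N) S₂) + sumTo (suc N) S₃) + sumTo (suc N) S₄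
      ≈⟨ +-cong (+-cong (+-cong (crossSum-extend N (suc N) m (ℕₚ.n≤1+n N)) S₂≈) (S₃≈ m)) S₄≈ ⟩
    ((crossSum N m + y * crossSum N m) + crossSumPred N m) + y * crossSum N (suc m)
      ≈⟨ +-congʳ (+-congʳ (solve 2 (λ y X → X :+ y :* X := (:1 :+ y) :* X) refl y (crossSum N m))) ⟩
    (1# + y) * crossSum N m + crossSumPred N m + y * crossSum N (suc m) ∎
    where
    S₁ S₂ S₃ S₄ : ℕ → Carrier
    S₁ j = pow y j * (binom N j * binom N (m ℕ.+ j))
    S₂ j = pow y j * (binom₋ N j * binom₋ N (m ℕ.+ j))
    S₃ j = pow y j * (binom N j * binom₋ N (m ℕ.+ j))
    S₄ j = pow y j * (binom₋ N j * binom N (m ℕ.+ j))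
    S₂≈ : sumTo (suc N) S₂ ≈ y * crossSum N m
    S₂≈ = trans (sumTo-binom₋ N _) (*-congˡ (sumTo-cong N (λ j →
            *-congˡ (*-congˡ (reflexive (≡.cong (binom₋ N) (ℕₚ.+-suc m j)))))))
    S₃≈ : ∀ m → sumTo (suc N) (λ j → pow y j * (binom N j * binom₋ N (m ℕ.+ j))) ≈ crossSumPred N m
    S₃≈ zero    = trans (sumTo-cong (suc N) (λ j → *-congˡ (*-comm _ _))) (sumTo-binom₋ N (binom N))
    S₃≈ (suc m) = crossSum-extend N (suc N) m (ℕₚ.n≤1+n N)
    S₄≈ : sumTo (suc N) S₄ ≈ y * crossSum N (suc m)
    S₄≈ = trans (sumTo-binom₋ N _) (*-congˡ (sumTo-cong N (λ j →
            *-congˡ (*-congˡ (reflexive (≡.cong (binom N) (ℕₚ.+-suc m j)))))))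

  crossDiff : ℕ → ℕ → Carrier
  crossDiff N m = crossSum N m - y * crossSum N (suc (suc m))

  crossDiff-step : ∀ N m → crossDiff (suc N) m ≈ (1# + y) * crossDiff N m + atPred (crossDiff N) m + y * crossDiff N (suc m)
  crossDiff-step N zero = begin
    crossSum (suc N) 0 - y * crossSum (suc N) 2 ≈⟨ +-cong (crossSum-step N 0) (-‿cong (*-congˡ (crossSum-step N 2))) ⟩
    ((1# + y) * A 0 + y * A 1 + y * A 1) - y * ((1# + y) * A 2 + A 1 + y * A 3)
      ≈⟨ solve 5 (λ y a₀ a₁ a₂ a₃ → ((:1 :+ y) :* a₀ :+ y :* a₁ :+ y :* a₁) :- y :* ((:1 :+ y) :* a₂ :+ a₁ :+ y :* a₃)
                  := (:1 :+ y) :* (a₀ :- y :* a₂) :+ :0 :+ y :* (a₁ :- y :* a₃)) refl y _ _ _ _ ⟩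
    (1# + y) * crossDiff N 0 + 0# + y * crossDiff N 1 ∎
    where A = crossSum N
  crossDiff-step N (suc m) = begin
    crossSum (suc N) (suc m) - y * crossSum (suc N) (3 ℕ.+ m)
      ≈⟨ +-cong (crossSum-step N (suc m)) (-‿cong (*-congˡ (crossSum-step N (3 ℕ.+ m)))) ⟩
    ((1# + y) * A (1 ℕ.+ m) + A m + y * A (2 ℕ.+ m)) - y * ((1# + y) * A (3 ℕ.+ m) + A (2 ℕ.+ m) + y * A (4 ℕ.+ m))
      ≈⟨ solve 6 (λ y a₀ a₁ a₂ a₃ a₄ → ((:1 :+ y) :* a₁ :+ a₀ :+ y :* a₂) :- y :* ((:1 :+ y) :* a₃ :+ a₂ :+ y :* a₄)
                  := (:1 :+ y) :* (a₁ :- y :* a₃) :+ (a₀ :- y :* a₂) :+ y :* (a₂ :- y :* a₄)) refl y _ _ _ _ _ ⟩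
    (1# + y) * crossDiff N (suc m) + crossDiff N m + y * crossDiff N (2 ℕ.+ m) ∎
    where A = crossSum N

  crossDiff-vanish : ∀ N m → N < m → crossDiff N m ≈ 0#
  crossDiff-vanish N m N<m = begin
    crossSum N m - y * crossSum N (2 ℕ.+ m)
      ≈⟨ +-cong (crossSum-vanish N m N<m) (-‿cong (*-congˡ (crossSum-vanish N (2 ℕ.+ m) (ℕₚ.m<n⇒m<1+n (ℕₚ.m<n⇒m<1+n N<m))))) ⟩
    0# - y * 0#
      ≈⟨ solve 1 (λ y → :0 :- y :* :0 := :0) refl y ⟩
    0# ∎

  innerTerm : ℕ → ℕ → ℕ → Carrier
  innerTerm N m j = pow y j * (fromℕ ((N C j) ℕ.* (N C (m ℕ.+ j))) - fromℕ ((binomPred N j) ℕ.* (N C (m ℕ.+ j ℕ.+ 1))))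

  crossDiff≈inner : ∀ N m → sumTo (N ∸ m) (innerTerm N m) ≈ crossDiff N m
  crossDiff≈inner N m = begin
    sumTo (N ∸ m) (innerTerm N m)
      ≈⟨ sumTo-cong (N ∸ m) (λ j → trans (*-congˡ (+-cong (fromℕ-* (N C j) _) (-‿cong (fromℕ-* (binomPred N j) _))))
            (solve 3 (λ Y a b → Y :* (a :- b) := Y :* a :+ :- (Y :* b)) refl _ _ _)) ⟩
    sumTo (N ∸ m) (λ j → F₁ j + - F₂ j)       ≈⟨ trans (sumTo-distrib-+ (N ∸ m) _ _) (+-congˡ (sym (-‿distrib-sumTo (N ∸ m) F₂))) ⟩
    sumTo (N ∸ m) F₁ - sumTo (N ∸ m) F₂       ≈⟨ +-cong F₁≈ (-‿cong F₂≈) ⟩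
    crossDiff N m ∎
    where
    F₁ F₂ : ℕ → Carrier
    F₁ j = pow y j * (binom N j * binom N (m ℕ.+ j))
    F₂ j = pow y j * (binom₋ N j * binom N (m ℕ.+ j ℕ.+ 1))
    N<m+k : ∀ k → N ∸ m < k → N < m ℕ.+ k
    N<m+k k N∸m<k = ℕₚ.≤-<-trans (ℕₚ.m≤n+m∸n N m) (ℕₚ.+-monoʳ-< m N∸m<k)
    F₁≈ : sumTo (N ∸ m) F₁ ≈ crossSum N m
    F₁≈ = sym (sumTo-extend N (ℕₚ.m∸n≤m N m) (λ k N∸m<k → *-zero-middleʳ _ _ (binom-vanish N (m ℕ.+ k) (N<m+k k N∸m<k))))
    F₂≈ : sumTo (N ∸ m) F₂ ≈ y * crossSum N (2 ℕ.+ m)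
    F₂≈ = begin
      sumTo (N ∸ m) F₂
        ≈⟨ sumTo-extend (suc N) (ℕₚ.m≤n⇒m≤1+n (ℕₚ.m∸n≤m N m))
             (λ k N∸m<k → *-zero-middleʳ _ _ (binom-vanish N (m ℕ.+ k ℕ.+ 1) (ℕₚ.<-≤-trans (N<m+k k N∸m<k) (ℕₚ.m≤m+n (m ℕ.+ k) 1)))) ⟨
      sumTo (suc N) F₂
        ≈⟨ sumTo-binom₋ N _ ⟩
      y * sumTo N (λ j → pow y j * (binom N j * binom N (m ℕ.+ suc j ℕ.+ 1)))
        ≈⟨ *-congˡ (sumTo-cong N (λ j → *-congˡ (*-congˡ (reflexive (≡.cong (binom N) (index j)))))) ⟩
      y * crossSum N (2 ℕ.+ m) ∎
      where
      index : ∀ j → m ℕ.+ suc j ℕ.+ 1 ≡ 2 ℕ.+ m ℕ.+ j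
      index j = ≡.trans (ℕₚ.+-comm (m ℕ.+ suc j) 1) (≡.cong suc (ℕₚ.+-suc m j))

  ω : ℕ → ℕ → Carrier
  ω i n = pow (- y) i * pow q (suc i C 2) * qb (n ℕ.+ i) i

  Rsum : ℕ → ℕ → ℕ → Carrier
  Rsum B N n = sumTo B (λ i → ω i n * crossDiff N (n ℕ.+ 2 ℕ.* i))

  n<2*[1+⌊n/2⌋] : ∀ n → n < 2 ℕ.* suc ⌊ n /2⌋
  n<2*[1+⌊n/2⌋] zero          = s≤s z≤n
  n<2*[1+⌊n/2⌋] (suc zero)    = s≤s (s≤s z≤n)
  n<2*[1+⌊n/2⌋] (suc (suc n)) = ≡.subst (suc (suc n) <_) (≡.sym (ℕₚ.*-suc 2 (suc ⌊ n /2⌋))) (s≤s (s≤s (n<2*[1+⌊n/2⌋] n)))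

  Rcoef≈Rsum : ∀ N n B → ⌊ (N ∸ n) /2⌋ ≤ B → Rcoef y q N n ≈ Rsum B N n
  Rcoef≈Rsum N n B ⌊N∸n/2⌋≤B = trans (sumTo-cong ⌊ (N ∸ n) /2⌋ (λ i → *-congˡ (inner i)))
    (sym (sumTo-extend B ⌊N∸n/2⌋≤B (λ i ⌊N∸n/2⌋<i → trans (*-congˡ (crossDiff-vanish N _ (N<n+2i i ⌊N∸n/2⌋<i))) (zeroʳ _))))
    where
    N<n+2i : ∀ i → ⌊ (N ∸ n) /2⌋ < i → N < n ℕ.+ 2 ℕ.* i
    N<n+2i i ⌊N∸n/2⌋<i = ℕₚ.≤-<-trans (ℕₚ.m≤n+m∸n N n)
      (ℕₚ.+-monoʳ-< n (ℕₚ.<-≤-trans (n<2*[1+⌊n/2⌋] (N ∸ n)) (ℕₚ.*-monoʳ-≤ 2 ⌊N∸n/2⌋<i)))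
    inner : ∀ i → sumTo (N ∸ n ∸ 2 ℕ.* i) (innerTerm N (n ℕ.+ 2 ℕ.* i)) ≈ crossDiff N (n ℕ.+ 2 ℕ.* i)
    inner i = ≡.subst (λ b → sumTo b (innerTerm N (n ℕ.+ 2 ℕ.* i)) ≈ crossDiff N (n ℕ.+ 2 ℕ.* i))
                      (≡.sym (ℕₚ.∸-+-assoc N n (2 ℕ.* i))) (crossDiff≈inner N (n ℕ.+ 2 ℕ.* i))

  Rcoef-vanish : ∀ N n → N < n → Rcoef y q N n ≈ 0#
  Rcoef-vanish N n N<n = trans (Rcoef≈Rsum N n _ ℕₚ.≤-refl)
    (sumTo-zero ⌊ (N ∸ n) /2⌋ (λ i _ → trans (*-congˡ (crossDiff-vanish N _ (ℕₚ.<-≤-trans N<n (ℕₚ.m≤m+n n _)))) (zeroʳ _)))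

  Rcoef-initial : Rcoef y q 0 0 ≈ 1#
  Rcoef-initial = trans (Rcoef≈Rsum 0 0 0 z≤n)
    (solve 1 (λ y → :1 :* :1 :* :1 :* ((:1 :* ((:1 :+ :0) :* (:1 :+ :0))) :- y :* (:1 :* ((:1 :+ :0) :* :0))) := :1) refl y)

  Rcoef≈Rsum-≥ : ∀ N n B → N ≤ B → Rcoef y q N n ≈ Rsum B N n
  Rcoef≈Rsum-≥ N n B N≤B = Rcoef≈Rsum N n B (ℕₚ.≤-trans (ℕₚ.⌊n/2⌋≤n (N ∸ n)) (ℕₚ.≤-trans (ℕₚ.m∸n≤m N n) N≤B))

  mergeShifted : (ℕ → Carrier) → (ℕ → Carrier) → ℕ → Carrier
  mergeShifted G H zero    = G 0
  mergeShifted G H (suc i) = G (suc i) + H i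

  Rsum-merge : ∀ N m B (G H : ℕ → Carrier) → N ≤ B →
    sumTo B (λ i → G i * crossDiff N (m ℕ.+ 2 ℕ.* i)) + sumTo B (λ i → H i * crossDiff N (suc (suc (m ℕ.+ 2 ℕ.* i))))
      ≈ sumTo B (λ i → mergeShifted G H i * crossDiff N (m ℕ.+ 2 ℕ.* i))
  Rsum-merge N m B G H N≤B = begin
    sumTo B (λ i → G i * T i) + sumTo B (λ i → H i * crossDiff N (suc (suc (m ℕ.+ 2 ℕ.* i))))
      ≈⟨ +-cong (sym (drop-top G)) (sumTo-cong B (λ i → *-congˡ (reflexive (≡.cong (crossDiff N) (index i))))) ⟩
    sumTo (suc B) (λ i → G i * T i) + sumTo B (λ i → H i * T (suc i))
      ≈⟨ +-congʳ (sumTo-sucˡ B _) ⟩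
    (G 0 * T 0 + sumTo B (λ i → G (suc i) * T (suc i))) + sumTo B (λ i → H i * T (suc i))
      ≈⟨ trans (+-assoc _ _ _) (+-congˡ (sym (sumTo-distrib-+ B _ _))) ⟩
    G 0 * T 0 + sumTo B (λ i → G (suc i) * T (suc i) + H i * T (suc i))
      ≈⟨ +-congˡ (sumTo-cong B (λ i → sym (distribʳ _ _ _))) ⟩
    G 0 * T 0 + sumTo B (λ i → mergeShifted G H (suc i) * T (suc i))
      ≈⟨ sumTo-sucˡ B _ ⟨
    sumTo (suc B) (λ i → mergeShifted G H i * T i)
      ≈⟨ drop-top (mergeShifted G H) ⟩
    sumTo B (λ i → mergeShifted G H i * T i) ∎
    where
    T : ℕ → Carrier
    T i = crossDiff N (m ℕ.+ 2 ℕ.* i)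
    index : ∀ i → suc (suc (m ℕ.+ 2 ℕ.* i)) ≡ m ℕ.+ 2 ℕ.* suc i
    index i = ≡.trans (≡.cong suc (≡.sym (ℕₚ.+-suc m (2 ℕ.* i))))
                (≡.trans (≡.sym (ℕₚ.+-suc m (suc (2 ℕ.* i)))) (≡.cong (m ℕ.+_) (≡.sym (ℕₚ.*-suc 2 i))))
    drop-top : ∀ F → sumTo (suc B) (λ i → F i * T i) ≈ sumTo B (λ i → F i * T i)
    drop-top F = trans (+-congˡ (trans (*-congˡ (crossDiff-vanish N _ N<top)) (zeroʳ _))) (+-identityʳ _)
      where
      N<top : N < m ℕ.+ 2 ℕ.* suc B
      N<top = ℕₚ.<-≤-trans (s≤s N≤B) (ℕₚ.≤-trans (ℕₚ.m≤m+n (suc B) _) (ℕₚ.m≤n+m _ m))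

  pow-q-triangular : ∀ i → pow q (suc (suc i) C 2) ≈ pow q (suc i C 2) * pow q (suc i)
  pow-q-triangular i = trans (reflexive (≡.cong (pow q) triangular)) (trans (pow-+ q (suc i) _) (*-comm _ _))
    where
    triangular : suc (suc i) C 2 ≡ suc i ℕ.+ (suc i C 2)
    triangular = ≡.trans (≡.sym (nCk+nC[k+1]≡[n+1]C[k+1] (suc i) 1)) (≡.cong (ℕ._+ (suc i C 2)) (nC1≡n (suc i)))

  ω-step : ∀ n i → ω (suc i) (suc n) + y * ω i (suc n) ≈ ω (suc i) n + κ (suc (suc n)) * ω i (suc (suc n))
  ω-step n i = begin
    (- y * Y) * pow q (suc (suc i) C 2) * qb (suc n ℕ.+ suc i) (suc i) + y * (Y * Qc * F₁)
      ≈⟨ +-congʳ (*-cong (*-congˡ (pow-q-triangular i)) (reflexive (≡.cong (λ m → qb m (suc i)) (≡.cong suc (ℕₚ.+-suc n i))))) ⟩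
    (- y * Y) * (Qc * Qi) * (F₁ + Qi * F₁′) + y * (Y * Qc * F₁)
      ≈⟨ solve 6 (λ y Y Qc Qi F₁ F₁′ → (:- y :* Y) :* (Qc :* Qi) :* (F₁ :+ Qi :* F₁′) :+ y :* (Y :* Qc :* F₁)
             := (:- y :* Y) :* (Qc :* Qi) :* F₁′ :+ y :* Y :* Qc :* ((:1 :- Qi) :* (F₁ :+ Qi :* F₁′))) refl y Y Qc Qi F₁ F₁′ ⟩
    (- y * Y) * (Qc * Qi) * F₁′ + y * Y * Qc * ((1# - Qi) * (F₁ + Qi * F₁′)) ≈⟨ +-congˡ (*-congˡ absorb) ⟩
    (- y * Y) * (Qc * Qi) * F₁′ + y * Y * Qc * ((1# - Qr) * F₂)
      ≈⟨ solve 7 (λ y Y Qc Qi F₁′ Qr F₂ → (:- y :* Y) :* (Qc :* Qi) :* F₁′ :+ y :* Y :* Qc :* ((:1 :- Qr) :* F₂)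
             := (:- y :* Y) :* (Qc :* Qi) :* F₁′ :+ (y :* (:1 :- Qr)) :* (Y :* Qc :* F₂)) refl y Y Qc Qi F₁′ Qr F₂ ⟩
    (- y * Y) * (Qc * Qi) * F₁′ + (y * (1# - Qr)) * (Y * Qc * F₂)
      ≈⟨ +-congʳ (*-cong (*-congˡ (sym (pow-q-triangular i))) (reflexive (≡.cong (λ m → qb m (suc i)) (≡.sym (ℕₚ.+-suc n i))))) ⟩
    ω (suc i) n + κ (suc (suc n)) * ω i (suc (suc n)) ∎
    where
    Y  = pow (- y) i
    Qc = pow q (suc i C 2)
    Qi = pow q (suc i)
    Qr = pow q (suc (suc n))
    F₁  = qb (suc (n ℕ.+ i)) i
    F₁′ = qb (suc (n ℕ.+ i)) (suc i)
    F₂  = qb (suc (suc (n ℕ.+ i))) i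
    absorb : (1# - Qi) * (F₁ + Qi * F₁′) ≈ (1# - Qr) * F₂
    absorb = ≡.subst (λ m → (1# - Qi) * qb m (suc i) ≈ (1# - Qr) * qb m i) (ℕₚ.+-comm i (suc (suc n))) (qbinom-suc-lower i (suc (suc n)))

  ω-step-zero : ∀ i → ω (suc i) 0 + y * ω i 0 ≈ κ 1 * ω i 1
  ω-step-zero i = begin
    (- y * Y) * pow q (suc (suc i) C 2) * qb (suc i) (suc i) + y * (Y * Qc * qb i i)
      ≈⟨ +-cong (*-cong (*-congˡ (pow-q-triangular i)) (qbinom-diag (suc i))) (*-congˡ (*-congˡ (qbinom-diag i))) ⟩
    (- y * Y) * (Qc * Qi) * 1# + y * (Y * Qc * 1#)
      ≈⟨ solve 4 (λ y Y Qc Qi → (:- y :* Y) :* (Qc :* Qi) :* :1 :+ y :* (Y :* Qc :* :1) := y :* Y :* Qc :* (:1 :- Qi)) refl y Y Qc Qi ⟩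
    y * Y * Qc * (1# - Qi) ≈⟨ *-congˡ absorb ⟩
    y * Y * Qc * ((1# - q * 1#) * qb (suc i) i)
      ≈⟨ solve 5 (λ y Y Qc q F → y :* Y :* Qc :* ((:1 :- q :* :1) :* F) := (y :* (:1 :- q :* :1)) :* (Y :* Qc :* F)) refl y Y Qc q (qb (suc i) i) ⟩
    κ 1 * ω i 1 ∎
    where
    Y  = pow (- y) i
    Qc = pow q (suc i C 2)
    Qi = pow q (suc i)
    absorb : 1# - Qi ≈ (1# - q * 1#) * qb (suc i) i
    absorb = trans (sym (trans (*-congˡ (qbinom-diag (suc i))) (*-identityʳ _)))
               (≡.subst (λ m → (1# - Qi) * qb m (suc i) ≈ (1# - q * 1#) * qb m i) (ℕₚ.+-comm i 1) (qbinom-suc-lower i 1))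

  sumTo-scaleˡ : ∀ B x (G T : ℕ → Carrier) → x * sumTo B (λ i → G i * T i) ≈ sumTo B (λ i → (x * G i) * T i)
  sumTo-scaleˡ B x G T = trans (*-distribˡ-sumTo B x _) (sumTo-cong B (λ i → sym (*-assoc _ _ _)))

  Rsum-neighbours : ∀ N n →
    sumTo (suc N) (λ i → ω i n * atPred (crossDiff N) (n ℕ.+ 2 ℕ.* i)) + y * sumTo (suc N) (λ i → ω i n * crossDiff N (suc (n ℕ.+ 2 ℕ.* i)))
      ≈ atPred (Rcoef y q N) n + κ (suc n) * Rcoef y q N (suc n)
  Rsum-neighbours N (suc n) = begin
    sumTo B (λ i → ω i (suc n) * crossDiff N (n ℕ.+ 2 ℕ.* i)) + y * sumTo B (λ i → ω i (suc n) * crossDiff N (suc (suc (n ℕ.+ 2 ℕ.* i))))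
      ≈⟨ +-congˡ (sumTo-scaleˡ B y _ _) ⟩
    sumTo B (λ i → ω i (suc n) * crossDiff N (n ℕ.+ 2 ℕ.* i)) + sumTo B (λ i → (y * ω i (suc n)) * crossDiff N (suc (suc (n ℕ.+ 2 ℕ.* i))))
      ≈⟨ Rsum-merge N n B _ _ (ℕₚ.n≤1+n N) ⟩
    sumTo B (λ i → mergeShifted (λ i → ω i (suc n)) (λ i → y * ω i (suc n)) i * crossDiff N (n ℕ.+ 2 ℕ.* i))
      ≈⟨ sumTo-cong B (λ { zero → refl ; (suc i) → *-congʳ (ω-step n i) }) ⟩
    sumTo B (λ i → mergeShifted (λ i → ω i n) (λ i → κ (suc (suc n)) * ω i (suc (suc n))) i * crossDiff N (n ℕ.+ 2 ℕ.* i))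
      ≈⟨ Rsum-merge N n B _ _ (ℕₚ.n≤1+n N) ⟨
    Rsum B N n + sumTo B (λ i → (κ (suc (suc n)) * ω i (suc (suc n))) * crossDiff N (suc (suc (n ℕ.+ 2 ℕ.* i))))
      ≈⟨ +-cong (sym (Rcoef≈Rsum-≥ N n B (ℕₚ.n≤1+n N)))
                (sym (trans (*-congˡ (Rcoef≈Rsum-≥ N (suc (suc n)) B (ℕₚ.n≤1+n N))) (sumTo-scaleˡ B (κ (suc (suc n))) _ _))) ⟩
    Rcoef y q N n + κ (suc (suc n)) * Rcoef y q N (suc (suc n)) ∎
    where B = suc N
  Rsum-neighbours N zero = begin
    sumTo B (λ i → ω i 0 * atPred (crossDiff N) (2 ℕ.* i)) + y * sumTo B (λ i → ω i 0 * crossDiff N (suc (2 ℕ.* i)))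
      ≈⟨ +-cong odd (sumTo-scaleˡ B y _ _) ⟩
    sumTo B (λ i → ω (suc i) 0 * crossDiff N (1 ℕ.+ 2 ℕ.* i)) + sumTo B (λ i → (y * ω i 0) * crossDiff N (1 ℕ.+ 2 ℕ.* i))
      ≈⟨ sumTo-distrib-+ B _ _ ⟨
    sumTo B (λ i → ω (suc i) 0 * crossDiff N (1 ℕ.+ 2 ℕ.* i) + (y * ω i 0) * crossDiff N (1 ℕ.+ 2 ℕ.* i))
      ≈⟨ sumTo-cong B (λ i → trans (sym (distribʳ _ _ _)) (*-congʳ (ω-step-zero i))) ⟩
    sumTo B (λ i → (κ 1 * ω i 1) * crossDiff N (1 ℕ.+ 2 ℕ.* i))
      ≈⟨ trans (*-congˡ (Rcoef≈Rsum-≥ N 1 B (ℕₚ.n≤1+n N))) (sumTo-scaleˡ B _ _ _) ⟨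
    κ 1 * Rcoef y q N 1
      ≈⟨ +-identityˡ _ ⟨
    0# + κ 1 * Rcoef y q N 1 ∎
    where
    B = suc N
    odd : sumTo B (λ i → ω i 0 * atPred (crossDiff N) (2 ℕ.* i)) ≈ sumTo B (λ i → ω (suc i) 0 * crossDiff N (1 ℕ.+ 2 ℕ.* i))
    odd = begin
      sumTo (suc N) (λ i → ω i 0 * atPred (crossDiff N) (2 ℕ.* i))
        ≈⟨ sumTo-sucˡ N _ ⟩
      ω 0 0 * 0# + sumTo N (λ i → ω (suc i) 0 * crossDiff N (i ℕ.+ suc (i ℕ.+ 0)))
        ≈⟨ +-cong (zeroʳ _) (sumTo-cong N (λ i → *-congˡ (reflexive (≡.cong (crossDiff N) (ℕₚ.+-suc i (i ℕ.+ 0)))))) ⟩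
      0# + sumTo N (λ i → ω (suc i) 0 * crossDiff N (1 ℕ.+ 2 ℕ.* i))
        ≈⟨ +-identityˡ _ ⟩
      sumTo N (λ i → ω (suc i) 0 * crossDiff N (1 ℕ.+ 2 ℕ.* i))
        ≈⟨ trans (+-congˡ (trans (*-congˡ (crossDiff-vanish N _ N<top)) (zeroʳ _))) (+-identityʳ _) ⟨
      sumTo B (λ i → ω (suc i) 0 * crossDiff N (1 ℕ.+ 2 ℕ.* i)) ∎
      where
      N<top : N < 1 ℕ.+ 2 ℕ.* suc N
      N<top = s≤s (ℕₚ.≤-trans (ℕₚ.n≤1+n N) (ℕₚ.m≤m+n (suc N) _))

  Rcoef-step : ∀ N n → Rcoef y q (suc N) n ≈ (1# + y) * Rcoef y q N n + atPred (Rcoef y q N) n + κ (suc n) * Rcoef y q N (suc n)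
  Rcoef-step N n = begin
    Rcoef y q (suc N) n
      ≈⟨ Rcoef≈Rsum-≥ (suc N) n (suc N) ℕₚ.≤-refl ⟩
    sumTo (suc N) (λ i → ω i n * crossDiff (suc N) (m i))
      ≈⟨ sumTo-cong (suc N) (λ i → trans (*-congˡ (crossDiff-step N (m i)))
           (solve 5 (λ w y T₀ P T₁ → w :* ((:1 :+ y) :* T₀ :+ P :+ y :* T₁) := (:1 :+ y) :* (w :* T₀) :+ (w :* P :+ y :* (w :* T₁))) refl _ _ _ _ _)) ⟩
    sumTo (suc N) (λ i → (1# + y) * (ω i n * crossDiff N (m i)) + (ω i n * atPred (crossDiff N) (m i) + y * (ω i n * crossDiff N (suc (m i)))))
      ≈⟨ trans (sumTo-distrib-+ (suc N) _ _) (+-cong (sym (*-distribˡ-sumTo (suc N) _ _))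
           (trans (sumTo-distrib-+ (suc N) _ _) (+-congˡ (sym (*-distribˡ-sumTo (suc N) _ _))))) ⟩
    (1# + y) * Rsum (suc N) N n + (sumTo (suc N) (λ i → ω i n * atPred (crossDiff N) (m i)) + y * sumTo (suc N) (λ i → ω i n * crossDiff N (suc (m i))))
      ≈⟨ +-cong (*-congˡ (sym (Rcoef≈Rsum-≥ N n (suc N) (ℕₚ.n≤1+n N)))) (Rsum-neighbours N n) ⟩
    (1# + y) * Rcoef y q N n + (atPred (Rcoef y q N) n + κ (suc n) * Rcoef y q N (suc n))
      ≈⟨ +-assoc _ _ _ ⟨
    (1# + y) * Rcoef y q N n + atPred (Rcoef y q N) n + κ (suc n) * Rcoef y q N (suc n) ∎
    where
    m : ℕ → ℕ
    m i = n ℕ.+ 2 ℕ.* i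

  Rcoef-recursive : Recursive (Rcoef y q)
  Rcoef-recursive = record
    { initial = Rcoef-initial
    ; vanish  = Rcoef-vanish
    ; step    = Rcoef-step
    }

theorem1p3 : {c ℓ : Level} (R : CommutativeRing c ℓ) (a b y q : CommutativeRing.Carrier R) (N : ℕ) →
    CommutativeRing._≈_ R
      (CommutativeRing._*_ R (Ops.pow R (CommutativeRing._-_ R (CommutativeRing.1# R) q) N) (Ops.Z R N a b y q))
      (Ops.sumTo R N (λ n → CommutativeRing._*_ R (Ops.Rcoef R y q N n) (Ops.Bpoly R n (Ops.tilde R q a) (Ops.tilde R q b) y q)))
theorem1p3 R a b y q = PartitionFunction.pasep-expansion R a b y q (Coefficients.Rcoef-recursive R y q)
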